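{- Let $G$ be a graph on $\nu$ vertices and let $n$ be a positive integer with $\nu\equiv n \pmod 2$, such that $\delta(G)\geq (\nu+n)/2-1$ and $\alpha(G)\leq (\nu-n)/2$. Then $G$ is not $n$-factor-critical if and only if $(\nu-n)/2$ is odd and $G=G_0\vee(G_1\cup G_2)$, where $G_0$ is a graph with $n$ vertices and $G_1=G_2=K_{(\nu-n)/2}$. Moreover, the bounds on $\delta(G)$ and $\alpha(G)$ in the hypotheses are sharp: the conclusion can fail if the hypothesis on $\delta(G)$ is weakened to $\delta(G)\geq (\nu+n)/2-2$, or if the hypothesis on $\alpha(G)$ is weakened to $\alpha(G)\leq (\nu-n)/2+1$.
   Context: All graphs are undirected, simple, finite and connected. $\delta(G)$ is the minimum degree and $\alpha(G)$ the independence number of $G$; $\nu(H)$ is the number of vertices of $H$. A graph $G$ is $n$-factor-critical if $G-S$ has a perfect matching for every $S\subseteq V(G)$ with $|S|=n$. For disjoint graphs $G_1,G_2$, the union $G_1\cup G_2$ has vertex set $V(G_1)\cup V(G_2)$ and edge set $E(G_1)\cup E(G_2)$; the join $G_1\vee G_2$ is obtained from $G_1\cup G_2$ by joining every vertex of $G_1$ to every vertex of $G_2$. $K_m$ is the complete graph on $m$ vertices. -}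

module Defs where

open import Data.Nat using (ℕ; zero; suc; _+_; _*_; _∸_; _≤_; _<_; _%_)
open import Data.Bool using (Bool; true; false)
open import Data.Fin using (Fin; splitAt)
open import Data.Fin.Subset using (Subset; ∣_∣; _∈_; _∉_)
open import Data.Vec using (tabulate)
open import Data.Sum using (_⊎_; inj₁; inj₂)
open import Data.Product using (Σ; _×_; _,_)
open import Function.Bundles using (_↔_; Inverse)
open import Relation.Binary.PropositionalEquality using (_≡_; refl)

record Graph (ν : ℕ) : Set where
  field
    adj    : Fin ν → Fin ν → Bool
    adj-sym     : ∀ i j → adj i j ≡ adj j i
    adj-irrefl  : ∀ i → adj i i ≡ false
open Graph public

data Walk {ν : ℕ} (G : Graph ν) : Fin ν → Fin ν → Set where
  here : ∀ {v} → Walk G v v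
  step : ∀ {u w v} → adj G u w ≡ true → Walk G w v → Walk G u v

Connected : ∀ {ν} → Graph ν → Set
Connected {ν} G = (u v : Fin ν) → Walk G u v

degree : ∀ {ν} → Graph ν → Fin ν → ℕ
degree G v = ∣ tabulate (adj G v) ∣

MinDegreeAtLeast : ∀ {ν} → Graph ν → ℕ → Set
MinDegreeAtLeast {ν} G k = (v : Fin ν) → k ≤ degree G v

Independent : ∀ {ν} → Graph ν → Subset ν → Set
Independent {ν} G S = (i j : Fin ν) → i ∈ S → j ∈ S → adj G i j ≡ false

IndependenceAtMost : ∀ {ν} → Graph ν → ℕ → Set
IndependenceAtMost {ν} G k = (S : Subset ν) → Independent G S → ∣ S ∣ ≤ k

record PerfectMatchingWithout {ν : ℕ} (G : Graph ν) (S : Subset ν) : Set where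
  field
    partner      : Fin ν → Fin ν
    partner-out  : ∀ v → v ∉ S → partner v ∉ S
    partner-adj  : ∀ v → v ∉ S → adj G v (partner v) ≡ true
    partner-invol : ∀ v → v ∉ S → partner (partner v) ≡ v

FactorCritical : ∀ {ν} → ℕ → Graph ν → Set
FactorCritical {ν} n G = (S : Subset ν) → ∣ S ∣ ≡ n → PerfectMatchingWithout G S

complete : (m : ℕ) → Graph m
complete m = record { adj = a ; adj-sym = s ; adj-irrefl = r }
  where
  open import Data.Fin using (_≟_)
  open import Relation.Nullary using (yes; no)
  open import Relation.Binary.PropositionalEquality using (sym)
  a : Fin m → Fin m → Bool
  a i j with i ≟ j
  ... | yes _ = false
  ... | no _  = true
  s : ∀ i j → a i j ≡ a j i
  s i j with i ≟ j | j ≟ i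
  ... | yes _ | yes _ = refl
  ... | no _  | no _  = refl
  ... | yes p | no q  with q (sym p)
  ... | ()
  s i j | no q | yes p with q (sym p)
  ... | ()
  r : ∀ i → a i i ≡ false
  r i with i ≟ i
  ... | yes _ = refl
  ... | no q with q refl
  ... | ()

comb : ∀ {a b} → (Fin a → Fin a → Bool) → (Fin b → Fin b → Bool) → Bool →
       Fin a ⊎ Fin b → Fin a ⊎ Fin b → Bool
comb f g c (inj₁ x) (inj₁ y) = f x y
comb f g c (inj₂ x) (inj₂ y) = g x y
comb f g c (inj₁ x) (inj₂ y) = c
comb f g c (inj₂ x) (inj₁ y) = c

comb-sym : ∀ {a b} (f : Fin a → Fin a → Bool) (g : Fin b → Fin b → Bool) c →
           (∀ x y → f x y ≡ f y x) → (∀ x y → g x y ≡ g y x) →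
           ∀ p q → comb f g c p q ≡ comb f g c q p
comb-sym f g c sf sg (inj₁ x) (inj₁ y) = sf x y
comb-sym f g c sf sg (inj₂ x) (inj₂ y) = sg x y
comb-sym f g c sf sg (inj₁ x) (inj₂ y) = refl
comb-sym f g c sf sg (inj₂ x) (inj₁ y) = refl

comb-irr : ∀ {a b} (f : Fin a → Fin a → Bool) (g : Fin b → Fin b → Bool) c →
           (∀ x → f x x ≡ false) → (∀ x → g x x ≡ false) →
           ∀ p → comb f g c p p ≡ false
comb-irr f g c rf rg (inj₁ x) = rf x
comb-irr f g c rf rg (inj₂ x) = rg x

-- cross = false: disjoint union; cross = true: join.
sumGraph : ∀ {a b} → Bool → Graph a → Graph b → Graph (a + b)
sumGraph {a} c G H = record
  { adj = λ i j → comb (adj G) (adj H) c (splitAt a i) (splitAt a j)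
  ; adj-sym = λ i j → comb-sym (adj G) (adj H) c (adj-sym G) (adj-sym H) (splitAt a i) (splitAt a j)
  ; adj-irrefl = λ i → comb-irr (adj G) (adj H) c (adj-irrefl G) (adj-irrefl H) (splitAt a i)
  }

_∪ᴳ_ : ∀ {a b} → Graph a → Graph b → Graph (a + b)
G ∪ᴳ H = sumGraph false G H

_∨ᴳ_ : ∀ {a b} → Graph a → Graph b → Graph (a + b)
G ∨ᴳ H = sumGraph true G H

Isomorphic : ∀ {a b} → Graph a → Graph b → Set
Isomorphic {a} {b} G H =
  Σ (Fin a ↔ Fin b) λ σ → ∀ i j → adj G i j ≡ adj H (Inverse.to σ i) (Inverse.to σ j)

JoinShape : ∀ {ν} → ℕ → ℕ → Graph ν → Set
JoinShape n m G = Σ (Graph n) λ G₀ → Isomorphic G (G₀ ∨ᴳ (complete m ∪ᴳ complete m))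

Odd : ℕ → Set
Odd m = m % 2 ≡ 1

-- Fix S ⊆ V(G) with |S| = n and let H = G − S, which has 2m vertices; the degree bound gives
-- every vertex at least m − 1 neighbours in H. Grow a matching p of H along augmenting paths
-- of length 1, 3 and 5. If two exposed vertices u, v admit none, a count shows that H is
-- covered by u, v, N_H(v) and p(N_H(u)). Hence a vertex of H outside {u, v} ∪ N_H(u) ∪ N_H(v)
-- would have all its H-neighbours in N_H(u) ∩ N_H(v), which p maps to such vertices again;
-- together with u and v they would form an independent set of more than m vertices. So H is
-- the disjoint union of {u} ∪ N_H(u) and {v} ∪ N_H(v), which are m-cliques with no edges
-- between them, completely joined to S, and m is odd because p pairs off N_H(u). This is the
-- shape G₀ ∨ (K_m ∪ K_m); conversely, removing G₀ from it leaves two odd cliques.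

module Submission where

open import Data.Bool using (Bool; true; false; not; _∧_; _∨_; if_then_else_)
open import Data.Bool.Properties using (¬-not; not-¬) renaming (_≟_ to _≟ᵇ_)
open import Data.Empty using (⊥; ⊥-elim)
open import Data.Fin using (Fin; zero; suc; splitAt; join)
import Data.Fin as F
open import Data.Fin.Properties using (_≟_; _<?_; <-asym; ≤∧≢⇒<; splitAt-join; join-splitAt; all?; any?; suc-injective)
open import Data.Fin.Subset using (Subset; ∣_∣; _∈_; _∉_; ⁅_⁆)
open import Data.Fin.Subset.Properties using (∣⁅x⁆∣≡1; x∈⁅y⁆⇒x≡y; _∈?_; anySubset?)
open import Data.Nat using (ℕ; zero; suc; pred; _+_; _*_; _∸_; _≤_; _<_; z≤n; s≤s; _%_; _≤?_)
open import Data.Nat.Induction using (<-wellFounded)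
open import Data.Nat.Properties
  using (module ≤-Reasoning; ≤-refl; ≤-trans; ≤-reflexive; ≤-antisym; <⇒≱; ≮⇒≥; m≤n⇒m≤1+n; +-suc; +-comm; +-identityʳ;
         +-mono-≤; +-monoˡ-≤; +-monoʳ-≤; +-cancelˡ-≤; +-cancelʳ-≤; +-cancelˡ-≡)
  renaming (_≟_ to _≟ℕ_; _<?_ to _<?ℕ_)
open import Data.Nat.Tactic.RingSolver using (solve-∀)
open import Data.Product using (Σ; ∃; _×_; _,_; proj₁; proj₂; uncurry)
open import Data.Sum using (_⊎_; inj₁; inj₂; [_,_]; [_,_]′; map₁; map₂)
open import Data.Unit using (tt)
open import Data.Vec using ([]; _∷_; tabulate; lookup)
open import Data.Vec.Properties using (lookup∘tabulate; []=⇒lookup; lookup⇒[]=)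
open import Function using (_∘_; id)
open import Function.Bundles using (_↔_; Inverse; _⇔_; mk⇔; mk↔ₛ′; Equivalence)
open import Induction.WellFounded using (Acc; acc)
open import Relation.Binary.PropositionalEquality using (_≡_; _≢_; refl; sym; trans; cong; cong₂; subst; subst₂; module ≡-Reasoning)
open import Relation.Nullary using (¬_; Dec; yes; no; does)
open import Relation.Nullary.Decidable using (dec-true; dec-false; toSum; True; False; toWitness; toWitnessFalse; _×-dec_; _→-dec_; ¬?)

open import Defs

-- Counting

∧-≡-true : ∀ {x y} → (x ∧ y) ≡ true → x ≡ true × y ≡ true
∧-≡-true {true} {true} _ = refl , refl

∧-intro : ∀ {x y} → x ≡ true → y ≡ true → (x ∧ y) ≡ true
∧-intro refl refl = refl

∨-≡-true : ∀ {x y} → (x ∨ y) ≡ true → x ≡ true ⊎ y ≡ true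
∨-≡-true {true} _ = inj₁ refl
∨-≡-true {false} e = inj₂ e

∨-introˡ : ∀ {x y} → x ≡ true → (x ∨ y) ≡ true
∨-introˡ refl = refl

∨-introʳ : ∀ {x y} → y ≡ true → (x ∨ y) ≡ true
∨-introʳ {true} _ = refl
∨-introʳ {false} e = e

not-≡-true : ∀ {x} → not x ≡ true → x ≡ false
not-≡-true {false} _ = refl

not-intro : ∀ {x} → x ≡ false → not x ≡ true
not-intro refl = refl

bool-ext : ∀ {x y} → (x ≡ true → y ≡ true) → (y ≡ true → x ≡ true) → x ≡ y
bool-ext {true} {true} _ _ = refl
bool-ext {true} {false} f _ = sym (f refl)
bool-ext {false} {true} _ g = g refl
bool-ext {false} {false} _ _ = refl

does-true : ∀ {A : Set} (a? : Dec A) → does a? ≡ true → A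
does-true (yes a) _ = a

does-false : ∀ {A : Set} (a? : Dec A) → does a? ≡ false → ¬ A
does-false (no ¬a) _ = ¬a

_==_ : ∀ {k} → Fin k → Fin k → Bool
i == j = does (i ≟ j)

==-refl : ∀ {k} (i : Fin k) → (i == i) ≡ true
==-refl i = dec-true (i ≟ i) refl

==⇒≡ : ∀ {k} {i j : Fin k} → (i == j) ≡ true → i ≡ j
==⇒≡ {i = i} {j} = does-true (i ≟ j)

≢⇒=/= : ∀ {k} {i j : Fin k} → i ≢ j → not (i == j) ≡ true
≢⇒=/= {i = i} {j} i≢j = not-intro (dec-false (i ≟ j) i≢j)

=/=⇒≢ : ∀ {k} {i j : Fin k} → not (i == j) ≡ true → i ≢ j
=/=⇒≢ {i = i} e refl = not-¬ (==-refl i) (not-≡-true e)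

suc-if : Bool → ℕ → ℕ
suc-if b n = if b then suc n else n

count : ∀ {k} → (Fin k → Bool) → ℕ
count {zero} P = 0
count {suc k} P = suc-if (P zero) (count (P ∘ suc))

_⊆_ : ∀ {k} → (Fin k → Bool) → (Fin k → Bool) → Set
P ⊆ Q = ∀ i → P i ≡ true → Q i ≡ true

Disjoint : ∀ {k} → (Fin k → Bool) → (Fin k → Bool) → Set
Disjoint P Q = ∀ i → P i ≡ true → Q i ≡ true → ⊥

count-cong : ∀ {k} {P Q : Fin k → Bool} → (∀ i → P i ≡ Q i) → count P ≡ count Q
count-cong {zero} _ = refl
count-cong {suc k} {P} {Q} P≗Q rewrite P≗Q zero = cong (suc-if (Q zero)) (count-cong (P≗Q ∘ suc))

suc-if-mono : ∀ {x y a b} → (x ≡ true → y ≡ true) → a ≤ b → suc-if x a ≤ suc-if y b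
suc-if-mono {true} {true} _ a≤b = s≤s a≤b
suc-if-mono {true} {false} x⇒y _ with () ← x⇒y refl
suc-if-mono {false} {true} _ a≤b = m≤n⇒m≤1+n a≤b
suc-if-mono {false} {false} _ a≤b = a≤b

count-mono : ∀ {k} {P Q : Fin k → Bool} → P ⊆ Q → count P ≤ count Q
count-mono {zero} _ = z≤n
count-mono {suc k} P⊆Q = suc-if-mono (P⊆Q zero) (count-mono (P⊆Q ∘ suc))

count-< : ∀ {k} {P Q : Fin k → Bool} → P ⊆ Q → (i : Fin k) → Q i ≡ true → P i ≡ false → count P < count Q
count-< {suc k} {P} {Q} P⊆Q zero Qi Pi rewrite Qi | Pi = s≤s (count-mono (P⊆Q ∘ suc))
count-< {suc k} {P} {Q} P⊆Q (suc i) Qi Pi = cases (P zero) (Q zero) (P⊆Q zero) (count-< (P⊆Q ∘ suc) i Qi Pi)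
  where
  cases : ∀ x y {a b} → (x ≡ true → y ≡ true) → a < b → suc-if x a < suc-if y b
  cases true true _ lt = s≤s lt
  cases true false x⇒y _ with () ← x⇒y refl
  cases false true _ lt = m≤n⇒m≤1+n lt
  cases false false _ lt = lt

count-none : ∀ {k} {P : Fin k → Bool} → (∀ i → P i ≡ false) → count P ≡ 0
count-none {zero} _ = refl
count-none {suc k} none rewrite none zero = count-none (none ∘ suc)

count-all : ∀ {k} {P : Fin k → Bool} → (∀ i → P i ≡ true) → count P ≡ k
count-all {zero} _ = refl
count-all {suc k} all rewrite all zero = cong suc (count-all (all ∘ suc))

count-singleton : ∀ {k} (j : Fin k) → count (_== j) ≡ 1
count-singleton {suc k} zero = cong suc (count-none {k} (λ _ → refl))
count-singleton {suc k} (suc j) = count-singleton j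

count-∨ : ∀ {k} {P Q : Fin k → Bool} → Disjoint P Q → count (λ i → P i ∨ Q i) ≡ count P + count Q
count-∨ {zero} _ = refl
count-∨ {suc k} {P} {Q} P#Q rewrite count-∨ (P#Q ∘ suc) = cases (P zero) (Q zero) (P#Q zero)
  where
  cases : ∀ x y {a b} → (x ≡ true → y ≡ true → ⊥) → suc-if (x ∨ y) (a + b) ≡ suc-if x a + suc-if y b
  cases true true disj with () ← disj refl refl
  cases true false _ = refl
  cases false true {a} {b} _ = sym (+-suc a b)
  cases false false _ = refl

count-split : ∀ {k} (P Q : Fin k → Bool) → count P ≡ count (λ i → P i ∧ Q i) + count (λ i → P i ∧ not (Q i))
count-split {zero} _ _ = refl
count-split {suc k} P Q rewrite count-split (P ∘ suc) (Q ∘ suc) = cases (P zero) (Q zero)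
  where
  cases : ∀ x y {a b} → suc-if x (a + b) ≡ suc-if (x ∧ y) a + suc-if (x ∧ not y) b
  cases true true = refl
  cases true false {a} {b} = sym (+-suc a b)
  cases false _ = refl

count-remove : ∀ {k} (P : Fin k → Bool) {j : Fin k} → P j ≡ true → count P ≡ suc (count (λ i → P i ∧ not (i == j)))
count-remove P {j} Pj =
  trans (count-split P (_== j)) (cong (_+ count (λ i → P i ∧ not (i == j))) (trans (count-cong only-j) (count-singleton j)))
  where
  only-j : ∀ i → (P i ∧ (i == j)) ≡ (i == j)
  only-j i = bool-ext (proj₂ ∘ ∧-≡-true) (λ e → ∧-intro (subst (λ x → P x ≡ true) (sym (==⇒≡ e)) Pj) e)

count-injective : ∀ {a b} {P : Fin a → Bool} {Q : Fin b → Bool} (f : Fin a → Fin b) →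
                  (∀ i → P i ≡ true → Q (f i) ≡ true) →
                  (∀ i j → P i ≡ true → P j ≡ true → f i ≡ f j → i ≡ j) → count P ≤ count Q
count-injective {zero} _ _ _ = z≤n
count-injective {suc a} {P = P} {Q} f maps inj with P zero in P0
... | false = count-injective (f ∘ suc) (maps ∘ suc) (λ i j Pi Pj e → suc-injective (inj (suc i) (suc j) Pi Pj e))
... | true = ≤-trans (s≤s rest) (≤-reflexive (sym (count-remove Q (maps zero P0))))
  where
  rest : count (P ∘ suc) ≤ count (λ i → Q i ∧ not (i == f zero))
  rest = count-injective (f ∘ suc)
    (λ i Pi → ∧-intro (maps (suc i) Pi) (≢⇒=/= (λ e → 0≢1+n (inj zero (suc i) P0 Pi (sym e)))))
    (λ i j Pi Pj e → suc-injective (inj (suc i) (suc j) Pi Pj e))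
    where
    0≢1+n : ∀ {i} → zero ≢ Fin.suc i
    0≢1+n ()

count-↔ : ∀ {a b} (σ : Fin a ↔ Fin b) (Q : Fin b → Bool) → count (Q ∘ Inverse.to σ) ≡ count Q
count-↔ σ Q = ≤-antisym
  (count-injective to (λ _ e → e) (λ i j _ _ e → trans (sym (from∘to i)) (trans (cong from e) (from∘to j))))
  (count-injective from (λ i e → subst (λ x → Q x ≡ true) (sym (to∘from i)) e)
    (λ i j _ _ e → trans (sym (to∘from i)) (trans (cong to e) (to∘from j))))
  where
  open Inverse σ
  from∘to = strictlyInverseʳ
  to∘from = strictlyInverseˡ

count-even : ∀ {k} {P : Fin k → Bool} (p : Fin k → Fin k) →
             (∀ i → P i ≡ true → P (p i) ≡ true) → (∀ i → P i ≡ true → p (p i) ≡ i) →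
             (∀ i → P i ≡ true → p i ≢ i) → ∃ λ h → count P ≡ h + h
count-even {P = P} p closed invol no-fix =
  count below , trans (count-split P descends) (cong (count below +_) (≤-antisym above≤below below≤above))
  where
  descends : Fin _ → Bool
  descends i = does (p i <? i)
  below above : Fin _ → Bool
  below i = P i ∧ descends i
  above i = P i ∧ not (descends i)
  p-injective : ∀ {Q} → Q ⊆ P → ∀ i j → Q i ≡ true → Q j ≡ true → p i ≡ p j → i ≡ j
  p-injective Q⊆P i j Qi Qj e = trans (sym (invol i (Q⊆P i Qi))) (trans (cong p e) (invol j (Q⊆P j Qj)))
  below→above : ∀ i → below i ≡ true → above (p i) ≡ true
  below→above i e with Pi , d ← ∧-≡-true e =
    ∧-intro (closed i Pi) (not-intro (dec-false (p (p i) <? p i)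
      (λ lt → <-asym (does-true (p i <? i) d) (subst (F._< p i) (invol i Pi) lt))))
  above→below : ∀ i → above i ≡ true → below (p i) ≡ true
  above→below i e with Pi , d ← ∧-≡-true e =
    ∧-intro (closed i Pi) (dec-true (p (p i) <? p i) (subst (F._< p i) (sym (invol i Pi))
      (≤∧≢⇒< (≮⇒≥ (does-false (p i <? i) (not-≡-true d))) (λ i≡pi → no-fix i Pi (sym i≡pi)))))
  above≤below : count above ≤ count below
  above≤below = count-injective p above→below (p-injective (λ i → proj₁ ∘ ∧-≡-true))
  below≤above : count below ≤ count above
  below≤above = count-injective p below→above (p-injective (λ i → proj₁ ∘ ∧-≡-true))

odd-%2 : ∀ h → suc (h + h) % 2 ≡ 1
odd-%2 zero = refl
odd-%2 (suc h) rewrite +-suc h h = odd-%2 h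

even-%2 : ∀ h → (h + h) % 2 ≡ 0
even-%2 zero = refl
even-%2 (suc h) rewrite +-suc h h = even-%2 h

Odd⇒≢even : ∀ {m} h → Odd m → m ≢ h + h
Odd⇒≢even h odd e with () ← trans (sym odd) (trans (cong (_% 2) e) (even-%2 h))

is-inj₁ : ∀ {A B : Set} → A ⊎ B → Bool
is-inj₁ (inj₁ _) = true
is-inj₁ (inj₂ _) = false

count-splitAt : ∀ a {b} (R : Fin a ⊎ Fin b → Bool) → count (R ∘ splitAt a) ≡ count (R ∘ inj₁) + count (R ∘ inj₂)
count-splitAt zero R = refl
count-splitAt (suc a) R with R (inj₁ zero)
... | true = cong suc (count-splitAt a (R ∘ map₁ suc))
... | false = count-splitAt a (R ∘ map₁ suc)

⊆∧count≥⇒⊇ : ∀ {k} {P Q : Fin k → Bool} → P ⊆ Q → count Q ≤ count P → Q ⊆ P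
⊆∧count≥⇒⊇ {P = P} P⊆Q Q≤P i Qi with P i in Pi
... | true = refl
... | false = ⊥-elim (<⇒≱ (count-< P⊆Q i Qi Pi) Q≤P)

split-cons : ∀ {k c d} (b : Bool) → (Fin k → Fin c ⊎ Fin d) →
             Fin (suc k) → Fin (suc-if b c) ⊎ Fin (suc-if (not b) d)
split-cons true f zero = inj₁ zero
split-cons true f (suc i) = map₁ suc (f i)
split-cons false f zero = inj₂ zero
split-cons false f (suc i) = map₂ suc (f i)

unsplit-cons : ∀ {k c d} (b : Bool) → (Fin c ⊎ Fin d → Fin k) →
               Fin (suc-if b c) ⊎ Fin (suc-if (not b) d) → Fin (suc k)
unsplit-cons true g (inj₁ zero) = zero
unsplit-cons true g (inj₁ (suc a)) = suc (g (inj₁ a))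
unsplit-cons true g (inj₂ b) = suc (g (inj₂ b))
unsplit-cons false g (inj₁ a) = suc (g (inj₁ a))
unsplit-cons false g (inj₂ zero) = zero
unsplit-cons false g (inj₂ (suc b)) = suc (g (inj₂ b))

split : ∀ {k} (P : Fin k → Bool) → Fin k → Fin (count P) ⊎ Fin (count (not ∘ P))
split {suc k} P = split-cons (P zero) (split (P ∘ suc))

unsplit : ∀ {k} (P : Fin k → Bool) → Fin (count P) ⊎ Fin (count (not ∘ P)) → Fin k
unsplit {zero} P (inj₁ ())
unsplit {zero} P (inj₂ ())
unsplit {suc k} P = unsplit-cons (P zero) (unsplit (P ∘ suc))

unsplit∘split : ∀ {k} (P : Fin k → Bool) i → unsplit P (split P i) ≡ i
unsplit∘split {suc k} P = cons (P zero) (unsplit∘split (P ∘ suc))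
  where
  cons : ∀ {c d} {f : Fin k → Fin c ⊎ Fin d} {g} b → (∀ i → g (f i) ≡ i) → ∀ i → unsplit-cons b g (split-cons b f i) ≡ i
  cons true _ zero = refl
  cons {f = f} true gf (suc i) with f i | gf i
  ... | inj₁ _ | e = cong suc e
  ... | inj₂ _ | e = cong suc e
  cons false _ zero = refl
  cons {f = f} false gf (suc i) with f i | gf i
  ... | inj₁ _ | e = cong suc e
  ... | inj₂ _ | e = cong suc e

split∘unsplit : ∀ {k} (P : Fin k → Bool) y → split P (unsplit P y) ≡ y
split∘unsplit {zero} P (inj₁ ())
split∘unsplit {zero} P (inj₂ ())
split∘unsplit {suc k} P = cons (P zero) (split∘unsplit (P ∘ suc))
  where
  cons : ∀ {c d} {f : Fin k → Fin c ⊎ Fin d} {g} b → (∀ y → f (g y) ≡ y) → ∀ y → split-cons b f (unsplit-cons b g y) ≡ y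
  cons true fg (inj₁ zero) = refl
  cons true fg (inj₁ (suc a)) = cong (map₁ suc) (fg (inj₁ a))
  cons true fg (inj₂ b) = cong (map₁ suc) (fg (inj₂ b))
  cons false fg (inj₁ a) = cong (map₂ suc) (fg (inj₁ a))
  cons false fg (inj₂ zero) = refl
  cons false fg (inj₂ (suc b)) = cong (map₂ suc) (fg (inj₂ b))

P∘unsplit : ∀ {k} (P : Fin k → Bool) y → P (unsplit P y) ≡ is-inj₁ y
P∘unsplit {zero} P (inj₁ ())
P∘unsplit {zero} P (inj₂ ())
P∘unsplit {suc k} P = cons (P zero) refl (P∘unsplit (P ∘ suc))
  where
  cons : ∀ {c d} {g : Fin c ⊎ Fin d → Fin k} b → P zero ≡ b →
         (∀ y → P (suc (g y)) ≡ is-inj₁ y) → ∀ y → P (unsplit-cons b g y) ≡ is-inj₁ y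
  cons true P0 _ (inj₁ zero) = P0
  cons true _ Pg (inj₁ (suc a)) = Pg (inj₁ a)
  cons true _ Pg (inj₂ b) = Pg (inj₂ b)
  cons false _ Pg (inj₁ a) = Pg (inj₁ a)
  cons false P0 _ (inj₂ zero) = P0
  cons false _ Pg (inj₂ (suc b)) = Pg (inj₂ b)

count-unsplit-inj₂ : ∀ {k} (P R : Fin k → Bool) → count (R ∘ unsplit P ∘ inj₂) ≡ count (λ i → not (P i) ∧ R i)
count-unsplit-inj₂ {zero} P R = refl
count-unsplit-inj₂ {suc k} P R =
  trans (cons (P zero) (unsplit (P ∘ suc))) (cong (suc-if (not (P zero) ∧ R zero)) (count-unsplit-inj₂ (P ∘ suc) (R ∘ suc)))
  where
  cons : ∀ {c d} b (g : Fin c ⊎ Fin d → Fin k) →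
         count {suc-if (not b) d} (R ∘ unsplit-cons b g ∘ inj₂) ≡ suc-if (not b ∧ R zero) (count (R ∘ suc ∘ g ∘ inj₂))
  cons true g = refl
  cons false g = refl

∣tabulate∣ : ∀ {k} (P : Fin k → Bool) → ∣ tabulate P ∣ ≡ count P
∣tabulate∣ {zero} P = refl
∣tabulate∣ {suc k} P with P zero
... | true = cong suc (∣tabulate∣ (P ∘ suc))
... | false = ∣tabulate∣ (P ∘ suc)

∣_∣≡count : ∀ {k} (S : Subset k) → ∣ S ∣ ≡ count (lookup S)
∣ [] ∣≡count = refl
∣ true ∷ S ∣≡count = cong suc ∣ S ∣≡count
∣ false ∷ S ∣≡count = ∣ S ∣≡count

∈-tabulate : ∀ {k} (P : Fin k → Bool) {i} → i ∈ tabulate P → P i ≡ true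
∈-tabulate P {i} i∈ = trans (sym (lookup∘tabulate P i)) ([]=⇒lookup i∈)

∉⇒false : ∀ {k} {S : Subset k} {i} → i ∉ S → lookup S i ≡ false
∉⇒false {S = S} {i} i∉S = ¬-not (i∉S ∘ lookup⇒[]= i S)

-- Partial matchings and short augmenting paths

Edge : ∀ {ν} → Graph ν → Fin ν → Fin ν → Set
Edge G a b = adj G a b ≡ true

edge-sym : ∀ {ν} (G : Graph ν) {a b} → Edge G a b → Edge G b a
edge-sym G {a} {b} e = trans (adj-sym G b a) e

edge-irrefl : ∀ {ν} (G : Graph ν) {a b} → Edge G a b → a ≢ b
edge-irrefl G {a} e refl = not-¬ e (adj-irrefl G a)

override : ∀ {ν} → (Fin ν → Fin ν) → Fin ν → Fin ν → Fin ν → Fin ν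
override f a b w = if w == a then b else f w

override-hit : ∀ {ν} f (a b : Fin ν) → override f a b a ≡ b
override-hit f a b rewrite ==-refl a = refl

override-miss : ∀ {ν} f (a b : Fin ν) {w} → w ≢ a → override f a b w ≡ f w
override-miss f a b {w} w≢a rewrite not-≡-true (≢⇒=/= w≢a) = refl

-- A partial matching of G − S is encoded by the involution p exchanging matched
-- partners; unmatched vertices, and the vertices of S, are its fixed points.
record IsMatching {ν} (G : Graph ν) (S : Fin ν → Bool) (p : Fin ν → Fin ν) : Set where
  field
    involutive : ∀ w → p (p w) ≡ w
    fixes-S : ∀ w → S w ≡ true → p w ≡ w
    along-edges : ∀ w → p w ≢ w → Edge G w (p w)

module Matchings {ν : ℕ} (G : Graph ν) (S : Fin ν → Bool) where

  Exposed : (Fin ν → Fin ν) → Fin ν → Set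
  Exposed p w = S w ≡ false × p w ≡ w

  link : (Fin ν → Fin ν) → Fin ν → Fin ν → Fin ν → Fin ν
  link p a b = override (override p a b) b a

  unlink : (Fin ν → Fin ν) → Fin ν → Fin ν → Fin ν → Fin ν
  unlink p x y = override (override p x x) y y

  module _ (p : Fin ν → Fin ν) {a b : Fin ν} (a≢b : a ≢ b) where

    link-a : link p a b a ≡ b
    link-a = trans (override-miss (override p a b) b a a≢b) (override-hit p a b)

    link-b : link p a b b ≡ a
    link-b = override-hit (override p a b) b a

    link-other : ∀ {w} → w ≢ a → w ≢ b → link p a b w ≡ p w
    link-other w≢a w≢b = trans (override-miss (override p a b) b a w≢b) (override-miss p a b w≢a)

    link-fixed : ∀ w → link p a b w ≡ w → p w ≡ w
    link-fixed w fixed with toSum (w ≟ a) | toSum (w ≟ b)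
    ... | inj₁ refl | _ = ⊥-elim (a≢b (sym (trans (sym link-a) fixed)))
    ... | inj₂ _ | inj₁ refl = ⊥-elim (a≢b (trans (sym link-b) fixed))
    ... | inj₂ w≢a | inj₂ w≢b = trans (sym (link-other w≢a w≢b)) fixed

    unlink-a : unlink p a b a ≡ a
    unlink-a = trans (override-miss (override p a a) b b a≢b) (override-hit p a a)

    unlink-b : unlink p a b b ≡ b
    unlink-b = override-hit (override p a a) b b

    unlink-other : ∀ {w} → w ≢ a → w ≢ b → unlink p a b w ≡ p w
    unlink-other w≢a w≢b = trans (override-miss (override p a a) b b w≢b) (override-miss p a a w≢a)

    unlink-fixed : ∀ w → unlink p a b w ≡ w → p w ≡ w ⊎ (w ≡ a ⊎ w ≡ b)
    unlink-fixed w fixed with toSum (w ≟ a) | toSum (w ≟ b)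
    ... | inj₁ w≡a | _ = inj₂ (inj₁ w≡a)
    ... | inj₂ _ | inj₁ w≡b = inj₂ (inj₂ w≡b)
    ... | inj₂ w≢a | inj₂ w≢b = inj₁ (trans (sym (unlink-other w≢a w≢b)) fixed)

  module _ {p : Fin ν → Fin ν} (M : IsMatching G S p) where
    open IsMatching M

    partner-≢ : ∀ {w z} → p w ≢ w → p z ≡ z → w ≢ z
    partner-≢ matched fixed refl = matched fixed

    p-injective : ∀ {i j} → p i ≡ p j → i ≡ j
    p-injective {i} {j} e = trans (sym (involutive i)) (trans (cong p e) (involutive j))

    p-matched : ∀ {w} → p w ≢ w → p (p w) ≢ p w
    p-matched {w} matched e = matched (trans (sym e) (involutive w))

    matched-outside-S : ∀ {w} → p w ≢ w → S w ≡ false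
    matched-outside-S matched = ¬-not (matched ∘ fixes-S _)

    p-outside-S : ∀ {w} → S w ≡ false → S (p w) ≡ false
    p-outside-S {w} Sw = ¬-not λ Spw → not-¬ (subst (λ z → S z ≡ true) (trans (sym (fixes-S _ Spw)) (involutive w)) Spw) Sw

    link-matching : ∀ {a b} → Exposed p a → Exposed p b → Edge G a b → IsMatching G S (link p a b)
    link-matching {a} {b} (Sa , pa) (Sb , pb) ab = record { involutive = inv ; fixes-S = fix ; along-edges = along }
      where
      a≢b = edge-irrefl G ab
      q = link p a b
      others : ∀ {w} → w ≢ a → w ≢ b → p w ≢ a × p w ≢ b
      others w≢a w≢b = (λ e → w≢a (p-injective (trans e (sym pa)))) , (λ e → w≢b (p-injective (trans e (sym pb))))
      inv : ∀ w → q (q w) ≡ w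
      inv w with toSum (w ≟ a) | toSum (w ≟ b)
      ... | inj₁ refl | _ rewrite link-a p a≢b = link-b p a≢b
      ... | inj₂ _ | inj₁ refl rewrite link-b p a≢b = link-a p a≢b
      ... | inj₂ w≢a | inj₂ w≢b rewrite link-other p a≢b w≢a w≢b =
        trans (link-other p a≢b (proj₁ (others w≢a w≢b)) (proj₂ (others w≢a w≢b))) (involutive w)
      fix : ∀ w → S w ≡ true → q w ≡ w
      fix w Sw with toSum (w ≟ a) | toSum (w ≟ b)
      ... | inj₁ refl | _ = ⊥-elim (not-¬ Sw Sa)
      ... | inj₂ _ | inj₁ refl = ⊥-elim (not-¬ Sw Sb)
      ... | inj₂ w≢a | inj₂ w≢b = trans (link-other p a≢b w≢a w≢b) (fixes-S w Sw)
      along : ∀ w → q w ≢ w → Edge G w (q w)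
      along w matched with toSum (w ≟ a) | toSum (w ≟ b)
      ... | inj₁ refl | _ rewrite link-a p a≢b = ab
      ... | inj₂ _ | inj₁ refl rewrite link-b p a≢b = edge-sym G ab
      ... | inj₂ w≢a | inj₂ w≢b rewrite link-other p a≢b w≢a w≢b = along-edges w matched

    unlink-matching : ∀ {x} → p x ≢ x → IsMatching G S (unlink p x (p x))
    unlink-matching {x} matched = record { involutive = inv ; fixes-S = fix ; along-edges = along }
      where
      y = p x
      x≢y : x ≢ y
      x≢y = matched ∘ sym
      q = unlink p x y
      others : ∀ {w} → w ≢ x → w ≢ y → p w ≢ x × p w ≢ y
      others w≢x w≢y = (λ e → w≢y (p-injective (trans e (sym (involutive x))))) , (λ e → w≢x (p-injective e))
      inv : ∀ w → q (q w) ≡ w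
      inv w with toSum (w ≟ x) | toSum (w ≟ y)
      ... | inj₁ refl | _ rewrite unlink-a p x≢y = unlink-a p x≢y
      ... | inj₂ _ | inj₁ refl rewrite unlink-b p x≢y = unlink-b p x≢y
      ... | inj₂ w≢x | inj₂ w≢y rewrite unlink-other p x≢y w≢x w≢y =
        trans (unlink-other p x≢y (proj₁ (others w≢x w≢y)) (proj₂ (others w≢x w≢y))) (involutive w)
      fix : ∀ w → S w ≡ true → q w ≡ w
      fix w Sw with toSum (w ≟ x) | toSum (w ≟ y)
      ... | inj₁ refl | _ = unlink-a p x≢y
      ... | inj₂ _ | inj₁ refl = unlink-b p x≢y
      ... | inj₂ w≢x | inj₂ w≢y = trans (unlink-other p x≢y w≢x w≢y) (fixes-S w Sw)
      along : ∀ w → q w ≢ w → Edge G w (q w)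
      along w unfixed with toSum (w ≟ x) | toSum (w ≟ y)
      ... | inj₁ refl | _ = ⊥-elim (unfixed (unlink-a p x≢y))
      ... | inj₂ _ | inj₁ refl = ⊥-elim (unfixed (unlink-b p x≢y))
      ... | inj₂ w≢x | inj₂ w≢y rewrite unlink-other p x≢y w≢x w≢y = along-edges w unfixed

  record Augmentation (p : Fin ν → Fin ν) (u v : Fin ν) : Set where
    field
      q : Fin ν → Fin ν
      matching : IsMatching G S q
      fixed⇒fixed : ∀ w → q w ≡ w → p w ≡ w
      covers-u : q u ≢ u
      covers-v : q v ≢ v

  exposed : (Fin ν → Fin ν) → Fin ν → Bool
  exposed p w = not (S w) ∧ (p w == w)

  augmentation-decreases : ∀ {p u v} → Exposed p u → (A : Augmentation p u v) →
                           count (exposed (Augmentation.q A)) < count (exposed p)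
  augmentation-decreases {p} {u} (Su , pu) A =
    count-< q⊆p u (∧-intro (not-intro Su) (subst (λ z → (z == u) ≡ true) (sym pu) (==-refl u))) qu
    where
    open Augmentation A
    q⊆p : exposed q ⊆ exposed p
    q⊆p w e with Sw , qw ← ∧-≡-true e = ∧-intro Sw (subst (λ z → (z == w) ≡ true) (sym (fixed⇒fixed w (==⇒≡ qw))) (==-refl w))
    qu : exposed q u ≡ false
    qu rewrite Su = not-≡-true (≢⇒=/= covers-u)

  -- Re-matching p x to v instead of x: v becomes covered and x exposed.
  record Shift (p : Fin ν → Fin ν) (x v : Fin ν) : Set where
    field
      q : Fin ν → Fin ν
      matching : IsMatching G S q
      exposes-x : q x ≡ x
      covers-v : q v ≢ v
      fixed : ∀ w → q w ≡ w → p w ≡ w ⊎ w ≡ x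
      agrees : ∀ {w} → w ≢ x → w ≢ p x → w ≢ v → q w ≡ p w

  module _ {p : Fin ν → Fin ν} (M : IsMatching G S p) where
    open IsMatching M

    augment₁ : ∀ {u v} → Exposed p u → Exposed p v → Edge G u v → Augmentation p u v
    augment₁ {u} {v} eu ev uv = record
      { q = link p u v
      ; matching = link-matching M eu ev uv
      ; fixed⇒fixed = link-fixed p u≢v
      ; covers-u = λ e → u≢v (sym (trans (sym (link-a p u≢v)) e))
      ; covers-v = λ e → u≢v (trans (sym (link-b p u≢v)) e)
      }
      where u≢v = edge-irrefl G uv

    shift : ∀ {x v} → p x ≢ x → Exposed p v → Edge G (p x) v → Shift p x v
    shift {x} {v} matched (Sv , pv) yv = record
      { q = q
      ; matching = link-matching M₁ (matched-outside-S M (p-matched M matched) , unlink-b p x≢y) (Sv , p₁v) yv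
      ; exposes-x = trans (link-other p₁ y≢v x≢y x≢v) (unlink-a p x≢y)
      ; covers-v = λ e → y≢v (trans (sym (link-b p₁ y≢v)) e)
      ; fixed = fixed
      ; agrees = λ w≢x w≢y w≢v → trans (link-other p₁ y≢v w≢y w≢v) (unlink-other p x≢y w≢x w≢y)
      }
      where
      y = p x
      x≢y : x ≢ y
      x≢y = matched ∘ sym
      x≢v = partner-≢ M matched pv
      y≢v = partner-≢ M (p-matched M matched) pv
      p₁ = unlink p x y
      M₁ = unlink-matching M matched
      p₁v : p₁ v ≡ v
      p₁v = trans (unlink-other p x≢y (x≢v ∘ sym) (y≢v ∘ sym)) pv
      q = link p₁ y v
      fixed : ∀ w → q w ≡ w → p w ≡ w ⊎ w ≡ x
      fixed w qw with unlink-fixed p x≢y w (link-fixed p₁ y≢v w qw)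
      ... | inj₁ pw = inj₁ pw
      ... | inj₂ (inj₁ w≡x) = inj₂ w≡x
      ... | inj₂ (inj₂ refl) = ⊥-elim (y≢v (sym (trans (sym (link-a p₁ y≢v)) qw)))

  -- An augmenting path u ⋯ x – p x – v is a shift at its end followed by an augmenting path u ⋯ x.
  augment-via-shift : ∀ {p u v x} → (sh : Shift p x v) → Augmentation (Shift.q sh) u x → Augmentation p u v
  augment-via-shift sh A = record
    { q = A.q
    ; matching = A.matching
    ; fixed⇒fixed = λ w qw → [ id , (λ { refl → ⊥-elim (A.covers-v qw) }) ] (sh.fixed w (A.fixed⇒fixed w qw))
    ; covers-u = A.covers-u
    ; covers-v = λ qv → sh.covers-v (A.fixed⇒fixed _ qv)
    }
    where
    module sh = Shift sh
    module A = Augmentation A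

  module _ {p : Fin ν → Fin ν} (M : IsMatching G S p) where
    open IsMatching M

    augment₃ : ∀ {u v x} → Exposed p u → Exposed p v → u ≢ v →
               Edge G u x → p x ≢ x → Edge G (p x) v → Augmentation p u v
    augment₃ {u} {v} {x} (Su , pu) ev u≢v ux matched yv =
      augment-via-shift sh (augment₁ sh.matching (Su , trans (sh.agrees u≢x u≢y u≢v) pu) (matched-outside-S M matched , sh.exposes-x) ux)
      where
      sh = shift M matched ev yv
      module sh = Shift sh
      u≢x = partner-≢ M matched pu ∘ sym
      u≢y = partner-≢ M (p-matched M matched) pu ∘ sym

  module _ {p : Fin ν → Fin ν} (M : IsMatching G S p) where
    open IsMatching M

    augment₅ : ∀ {u v x x'} → Exposed p u → Exposed p v → u ≢ v →
               Edge G u x → p x ≢ x → Edge G (p x) x' → p x' ≢ x' → Edge G (p x') v → x' ≢ x → Augmentation p u v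
    augment₅ {u} {v} {x} {x'} (Su , pu) ev@(_ , pv) u≢v ux matched yx' matched' y'v x'≢x =
      augment-via-shift sh (augment₃ sh.matching (Su , trans (sh.agrees u≢x' u≢y' u≢v) pu)
        (matched-outside-S M matched' , sh.exposes-x) u≢x' ux (subst (_≢ x) (sym qx) matched) (subst (λ z → Edge G z x') (sym qx) yx'))
      where
      sh = shift M matched' ev y'v
      module sh = Shift sh
      u≢x' = partner-≢ M matched' pu ∘ sym
      u≢y' = partner-≢ M (p-matched M matched') pu ∘ sym
      x≢y' : x ≢ p x'
      x≢y' x≡y' = edge-irrefl G (subst (λ z → Edge G z x') (trans (cong p x≡y') (involutive x')) yx') refl
      qx : sh.q x ≡ p x
      qx = sh.agrees (x'≢x ∘ sym) x≢y' (partner-≢ M matched pv)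

  module _ (p : Fin ν → Fin ν) where

    ExposedNeighbour : Fin ν → Set
    ExposedNeighbour a = ∃ λ w → Exposed p w × Edge G a w

    Path₃ : Fin ν → Fin ν → Set
    Path₃ a b = ∃ λ x → Edge G a x × p x ≢ x × Edge G (p x) b

    Path₅ : Fin ν → Fin ν → Set
    Path₅ a b = ∃ λ x → ∃ λ x' → Edge G a x × p x ≢ x × Edge G (p x) x' × p x' ≢ x' × Edge G (p x') b × x' ≢ x

  record Stuck (p : Fin ν → Fin ν) (u v : Fin ν) : Set where
    field
      matching : IsMatching G S p
      exposed-u : Exposed p u
      exposed-v : Exposed p v
      u≢v : u ≢ v
      no-neighbour-u : ¬ ExposedNeighbour p u
      no-neighbour-v : ¬ ExposedNeighbour p v
      no-path₃ : ¬ Path₃ p u v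
      no-path₅ : ¬ Path₅ p u v

  module _ {p : Fin ν → Fin ν} (M : IsMatching G S p) where
    open IsMatching M

    path₃-sym : ∀ {a b} → Path₃ p a b → Path₃ p b a
    path₃-sym {a} (x , ax , matched , yb) =
      p x , edge-sym G yb , p-matched M matched , subst (λ z → Edge G z a) (sym (involutive x)) (edge-sym G ax)

    path₅-sym : ∀ {a b} → Path₅ p a b → Path₅ p b a
    path₅-sym {a} (x , x' , ax , matched , yx' , matched' , y'b , x'≢x) =
      p x' , p x , edge-sym G y'b , p-matched M matched' ,
      subst (λ z → Edge G z (p x)) (sym (involutive x')) (edge-sym G yx') ,
      p-matched M matched , subst (λ z → Edge G z a) (sym (involutive x)) (edge-sym G ax) ,
      x'≢x ∘ p-injective M ∘ sym

  empty-matching : IsMatching G S id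
  empty-matching = record { involutive = λ _ → refl ; fixes-S = λ _ _ → refl ; along-edges = λ _ ne → ⊥-elim (ne refl) }

  Perfect : (Fin ν → Fin ν) → Set
  Perfect p = ∀ w → S w ≡ false → p w ≢ w

  record Improvement (p : Fin ν → Fin ν) : Set where
    field
      q : Fin ν → Fin ν
      matching : IsMatching G S q
      fewer-exposed : count (exposed q) < count (exposed p)

  improvement : ∀ {p u v} → Exposed p u → Augmentation p u v → Improvement p
  improvement eu A = record
    { q = Augmentation.q A ; matching = Augmentation.matching A ; fewer-exposed = augmentation-decreases eu A }

  module _ {p : Fin ν → Fin ν} (M : IsMatching G S p) where

    exposed? : ∀ w → Dec (Exposed p w)
    exposed? w = (S w ≟ᵇ false) ×-dec (p w ≟ w)

    exposed-neighbour? : ∀ a → Dec (ExposedNeighbour p a)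
    exposed-neighbour? a = any? λ w → exposed? w ×-dec (adj G a w ≟ᵇ true)

    path₃? : ∀ a b → Dec (Path₃ p a b)
    path₃? a b = any? λ x → (adj G a x ≟ᵇ true) ×-dec (¬? (p x ≟ x) ×-dec (adj G (p x) b ≟ᵇ true))

    path₅? : ∀ a b → Dec (Path₅ p a b)
    path₅? a b = any? λ x → any? λ x' → (adj G a x ≟ᵇ true) ×-dec (¬? (p x ≟ x) ×-dec ((adj G (p x) x' ≟ᵇ true) ×-dec
      (¬? (p x' ≟ x') ×-dec ((adj G (p x') b ≟ᵇ true) ×-dec ¬? (x' ≟ x)))))

    improve-or-stuck : ∀ {u v} → Exposed p u → Exposed p v → u ≢ v → Improvement p ⊎ Stuck p u v
    improve-or-stuck {u} {v} eu ev u≢v with exposed-neighbour? u | exposed-neighbour? v | path₃? u v | path₅? u v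
    ... | yes (w , ew , uw) | _ | _ | _ = inj₁ (improvement eu (augment₁ M eu ew uw))
    ... | no _ | yes (w , ew , vw) | _ | _ = inj₁ (improvement ev (augment₁ M ev ew vw))
    ... | no _ | no _ | yes (x , ux , mx , yv) | _ = inj₁ (improvement eu (augment₃ M eu ev u≢v ux mx yv))
    ... | no _ | no _ | no _ | yes (x , x' , ux , mx , yx' , mx' , y'v , x'≢x) =
      inj₁ (improvement eu (augment₅ M eu ev u≢v ux mx yx' mx' y'v x'≢x))
    ... | no ¬nu | no ¬nv | no ¬p₃ | no ¬p₅ = inj₂ (record
      { matching = M ; exposed-u = eu ; exposed-v = ev ; u≢v = u≢v
      ; no-neighbour-u = ¬nu ; no-neighbour-v = ¬nv ; no-path₃ = ¬p₃ ; no-path₅ = ¬p₅ })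

-- A perfect matching of G − S, or a two-clique split

IndependentSet : ∀ {ν} → Graph ν → (Fin ν → Bool) → Set
IndependentSet G J = ∀ i j → J i ≡ true → J j ≡ true → adj G i j ≡ false

record TwoCliqueSplit {ν} (G : Graph ν) (S : Fin ν → Bool) (m : ℕ) : Set where
  field
    A B : Fin ν → Bool
    m-odd : ∃ λ h → m ≡ suc (h + h)
    count-A : count A ≡ m
    count-B : count B ≡ m
    A-outside-S : ∀ w → A w ≡ true → S w ≡ false
    B-outside-S : ∀ w → B w ≡ true → S w ≡ false
    A#B : Disjoint A B
    A∪B : ∀ w → S w ≡ false → A w ≡ true ⊎ B w ≡ true
    A-clique : ∀ i j → A i ≡ true → A j ≡ true → i ≢ j → Edge G i j
    B-clique : ∀ i j → B i ≡ true → B j ≡ true → i ≢ j → Edge G i j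
    no-A-B-edge : ∀ i j → A i ≡ true → B j ≡ true → adj G i j ≡ false
    S-H-edge : ∀ i j → S i ≡ true → S j ≡ false → Edge G i j

suc+suc≡+2 : ∀ m → suc m + suc m ≡ m + (m + (1 + 1))
suc+suc≡+2 = solve-∀

balanced : ∀ {m a b} → m ≤ a → m ≤ b → suc a + suc b ≡ suc m + suc m → a ≡ m
balanced {m} {a} {b} m≤a m≤b e = ≤-antisym (+-cancelʳ-≤ m a m (begin
  a + m ≤⟨ +-monoʳ-≤ a m≤b ⟩
  a + b ≡⟨ cong (pred ∘ pred) (trans (cong suc (sym (+-suc a b))) (trans e (cong suc (+-suc m m)))) ⟩
  m + m ∎)) m≤a
  where open ≤-Reasoning

module PerfectMatchingOrSplit {ν : ℕ} (G : Graph ν) (S : Fin ν → Bool) (n m' : ℕ)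
  (|S|≡n : count S ≡ n) (|H|≡2m : count (not ∘ S) ≡ suc m' + suc m')
  (min-degree : ∀ w → n + m' ≤ count (adj G w))
  (independence : ∀ J → IndependentSet G J → count J ≤ suc m') where

  open Matchings G S

  N : Fin ν → Fin ν → Bool
  N w z = adj G w z ∧ not (S z)

  N-outside-S : ∀ {w z} → N w z ≡ true → S z ≡ false
  N-outside-S e = not-≡-true (proj₂ (∧-≡-true e))

  N-edge : ∀ {w z} → N w z ≡ true → Edge G w z
  N-edge e = proj₁ (∧-≡-true e)

  N-intro : ∀ {w z} → Edge G w z → S z ≡ false → N w z ≡ true
  N-intro wz Sz = ∧-intro wz (not-intro Sz)

  degree-split : ∀ w → count (adj G w) ≡ count (λ z → adj G w z ∧ S z) + count (N w)
  degree-split w = count-split (adj G w) S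

  m'≤|N| : ∀ w → m' ≤ count (N w)
  m'≤|N| w = +-cancelˡ-≤ n m' (count (N w)) (begin
    n + m'                                       ≤⟨ min-degree w ⟩
    count (adj G w)                              ≡⟨ degree-split w ⟩
    count (λ z → adj G w z ∧ S z) + count (N w)  ≤⟨ +-monoˡ-≤ (count (N w)) S-part≤n ⟩
    n + count (N w)                              ∎)
    where
    open ≤-Reasoning
    S-part≤n : count (λ z → adj G w z ∧ S z) ≤ n
    S-part≤n = ≤-trans (count-mono {Q = S} (λ z → proj₂ ∘ ∧-≡-true {adj G w z})) (≤-reflexive |S|≡n)

  -- The degree bound is tight here: N i ⊆ X − i and the neighbours of i in S are
  -- forced to be all of X − i and all of S.
  module Saturated {X : Fin ν → Bool} (|X| : count X ≡ suc m') {i} (Xi : X i ≡ true) (N⊆X : N i ⊆ X) where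

    X-i : Fin ν → Bool
    X-i z = X z ∧ not (z == i)

    |X-i| : count X-i ≡ m'
    |X-i| = cong pred (trans (sym (count-remove X Xi)) |X|)

    N⊆X-i : N i ⊆ X-i
    N⊆X-i z Nz = ∧-intro (N⊆X z Nz) (≢⇒=/= (edge-irrefl G (N-edge Nz) ∘ sym))

    adjacent-in-X : ∀ j → X j ≡ true → i ≢ j → Edge G i j
    adjacent-in-X j Xj i≢j =
      N-edge (⊆∧count≥⇒⊇ N⊆X-i (≤-trans (≤-reflexive |X-i|) (m'≤|N| i)) j (∧-intro Xj (≢⇒=/= (i≢j ∘ sym))))

    adjacent-to-S : ∀ s → S s ≡ true → Edge G i s
    adjacent-to-S s Ss = proj₁ (∧-≡-true (⊆∧count≥⇒⊇ {Q = S} (λ z → proj₂ ∘ ∧-≡-true {adj G i z}) |S|≤ s Ss))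
      where
      open ≤-Reasoning
      |S|≤ : count S ≤ count (λ z → adj G i z ∧ S z)
      |S|≤ = +-cancelʳ-≤ m' (count S) _ (begin
        count S + m'                                 ≡⟨ cong (_+ m') |S|≡n ⟩
        n + m'                                       ≤⟨ min-degree i ⟩
        count (adj G i)                              ≡⟨ degree-split i ⟩
        count (λ z → adj G i z ∧ S z) + count (N i)  ≤⟨ +-monoʳ-≤ _ (≤-trans (count-mono N⊆X-i) (≤-reflexive |X-i|)) ⟩
        count (λ z → adj G i z ∧ S z) + m'           ∎)

  module _ {p : Fin ν → Fin ν} (M : IsMatching G S p) where
    open IsMatching M

    N-matched : ∀ {a w} → ¬ ExposedNeighbour p a → N a w ≡ true → p w ≢ w
    N-matched {w = w} stuck Naw pw = stuck (w , (N-outside-S Naw , pw) , N-edge Naw)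

    -- For exposed a ≠ b with no augmenting path of length ≤ 3 between them, the sets
    -- p(N a), N b, {a}, {b} are disjoint in G − S and have at least 2m' + 2 = |G − S| elements.
    module Cover {a b : Fin ν} (ea : Exposed p a) (eb : Exposed p b) (a≢b : a ≢ b)
      (stuck-a : ¬ ExposedNeighbour p a) (stuck-b : ¬ ExposedNeighbour p b) (no-path : ¬ Path₃ p a b) where

      N-disjoint : ∀ w → N a (p w) ≡ true → N b w ≡ true → ⊥
      N-disjoint w Napw Nbw = no-path (p w , N-edge Napw , N-matched stuck-a Napw ,
        subst (λ z → Edge G z b) (sym (involutive w)) (edge-sym G (N-edge Nbw)))

      ends : Fin ν → Bool
      ends w = (w == a) ∨ (w == b)

      C : Fin ν → Bool
      C w = N a (p w) ∨ (N b w ∨ ends w)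

      Nb#ends : Disjoint (N b) ends
      Nb#ends w Nbw e with ∨-≡-true e
      ... | inj₁ w=a = stuck-b (a , ea , subst (Edge G b) (==⇒≡ {i = w} w=a) (N-edge Nbw))
      ... | inj₂ w=b = edge-irrefl G (subst (Edge G b) (==⇒≡ {i = w} w=b) (N-edge Nbw)) refl

      Nap#rest : Disjoint (N a ∘ p) (λ w → N b w ∨ ends w)
      Nap#rest w Napw e with ∨-≡-true e
      ... | inj₁ Nbw = N-disjoint w Napw Nbw
      ... | inj₂ e' with ∨-≡-true e'
      ... | inj₁ w=a = edge-irrefl G (subst (Edge G a) (cong p (==⇒≡ {i = w} w=a)) (N-edge Napw)) (sym (proj₂ ea))
      ... | inj₂ w=b = stuck-a (b , eb , subst (Edge G a) (trans (cong p (==⇒≡ {i = w} w=b)) (proj₂ eb)) (N-edge Napw))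

      a#b : Disjoint (_== a) (_== b)
      a#b w w=a w=b = a≢b (trans (sym (==⇒≡ {i = w} w=a)) (==⇒≡ {i = w} w=b))

      |C| : count C ≡ count (N a ∘ p) + (count (N b) + (1 + 1))
      |C| = trans (count-∨ Nap#rest) (cong (count (N a ∘ p) +_) (trans (count-∨ Nb#ends)
              (cong (count (N b) +_) (trans (count-∨ a#b) (cong₂ _+_ (count-singleton a) (count-singleton b))))))

      |N|≤|N∘p| : count (N a) ≤ count (N a ∘ p)
      |N|≤|N∘p| = count-injective p (λ i e → subst (λ z → N a z ≡ true) (sym (involutive i)) e) (λ _ _ _ _ → p-injective M)

      C⊆H : C ⊆ (not ∘ S)
      C⊆H w e with ∨-≡-true e
      ... | inj₁ Napw = not-intro (subst (λ z → S z ≡ false) (involutive w) (p-outside-S M (N-outside-S Napw)))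
      ... | inj₂ e' with ∨-≡-true e'
      ... | inj₁ Nbw = not-intro (N-outside-S Nbw)
      ... | inj₂ e'' with ∨-≡-true e''
      ... | inj₁ w=a = not-intro (subst (λ z → S z ≡ false) (sym (==⇒≡ {i = w} w=a)) (proj₁ ea))
      ... | inj₂ w=b = not-intro (subst (λ z → S z ≡ false) (sym (==⇒≡ {i = w} w=b)) (proj₁ eb))

      |H|≤|C| : count (not ∘ S) ≤ count C
      |H|≤|C| = begin
        count (not ∘ S)                               ≡⟨ |H|≡2m ⟩
        suc m' + suc m'                               ≡⟨ suc+suc≡+2 m' ⟩
        m' + (m' + (1 + 1))                           ≤⟨ +-mono-≤ (≤-trans (m'≤|N| a) |N|≤|N∘p|) (+-monoˡ-≤ 2 (m'≤|N| b)) ⟩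
        count (N a ∘ p) + (count (N b) + (1 + 1))     ≡⟨ sym |C| ⟩
        count C                                       ∎
        where open ≤-Reasoning

      covered : ∀ w → S w ≡ false → N a (p w) ≡ true ⊎ N b w ≡ true ⊎ w ≡ a ⊎ w ≡ b
      covered w Sw with ∨-≡-true (⊆∧count≥⇒⊇ C⊆H |H|≤|C| w (not-intro Sw))
      ... | inj₁ Napw = inj₁ Napw
      ... | inj₂ e with ∨-≡-true e
      ... | inj₁ Nbw = inj₂ (inj₁ Nbw)
      ... | inj₂ e' with ∨-≡-true e'
      ... | inj₁ w=a = inj₂ (inj₂ (inj₁ (==⇒≡ {i = w} w=a)))
      ... | inj₂ w=b = inj₂ (inj₂ (inj₂ (==⇒≡ {i = w} w=b)))

  module _ {p : Fin ν → Fin ν} {u v : Fin ν} (st : Stuck p u v) where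
    open Stuck st
    open IsMatching matching

    private
      Su = proj₁ exposed-u
      Sv = proj₁ exposed-v
      pu = proj₂ exposed-u
      pv = proj₂ exposed-v
      v≢u = u≢v ∘ sym
      no-path₅' : ¬ Path₅ p v u
      no-path₅' = no-path₅ ∘ path₅-sym matching

    module U = Cover matching exposed-u exposed-v u≢v no-neighbour-u no-neighbour-v no-path₃
    module V = Cover matching exposed-v exposed-u v≢u no-neighbour-v no-neighbour-u (no-path₃ ∘ path₃-sym matching)

    Nu-≢u : ∀ {w} → N u w ≡ true → w ≢ u
    Nu-≢u e = edge-irrefl G (N-edge e) ∘ sym

    Nu-≢v : ∀ {w} → N u w ≡ true → w ≢ v
    Nu-≢v e refl = no-neighbour-u (v , exposed-v , N-edge e)

    Nv-≢v : ∀ {w} → N v w ≡ true → w ≢ v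
    Nv-≢v e = edge-irrefl G (N-edge e) ∘ sym

    Nv-≢u : ∀ {w} → N v w ≡ true → w ≢ u
    Nv-≢u e refl = no-neighbour-v (u , exposed-u , N-edge e)

    p-into-Nu : ∀ {w} → S w ≡ false → N v w ≡ false → w ≢ u → w ≢ v → N u (p w) ≡ true
    p-into-Nu {w} Sw Nvw w≢u w≢v with U.covered w Sw
    ... | inj₁ Nupw = Nupw
    ... | inj₂ (inj₁ Nvw') = ⊥-elim (not-¬ Nvw' Nvw)
    ... | inj₂ (inj₂ (inj₁ w≡u)) = ⊥-elim (w≢u w≡u)
    ... | inj₂ (inj₂ (inj₂ w≡v)) = ⊥-elim (w≢v w≡v)

    p-into-Nv : ∀ {w} → S w ≡ false → N u w ≡ false → w ≢ u → w ≢ v → N v (p w) ≡ true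
    p-into-Nv {w} Sw Nuw w≢u w≢v with V.covered w Sw
    ... | inj₁ Nvpw = Nvpw
    ... | inj₂ (inj₁ Nuw') = ⊥-elim (not-¬ Nuw' Nuw)
    ... | inj₂ (inj₂ (inj₁ w≡v)) = ⊥-elim (w≢v w≡v)
    ... | inj₂ (inj₂ (inj₂ w≡u)) = ⊥-elim (w≢u w≡u)

    record Far (y : Fin ν) : Set where
      field
        S-y : S y ≡ false
        y≢u : y ≢ u
        y≢v : y ≢ v
        Nu-y : N u y ≡ false
        Nv-y : N v y ≡ false

    -- A far vertex y sends p y into N u ∩ N v, so a 5-path through y and any
    -- H-neighbour z of y would exist unless z lies in N u ∩ N v as well.
    far-neighbours : ∀ {y} → Far y → ∀ {z} → S z ≡ false → Edge G y z → N u z ≡ true × N v z ≡ true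
    far-neighbours {y} far {z} Sz yz = cases (N u z) (N v z) refl refl
      where
      open Far far
      z≢u : z ≢ u
      z≢u refl = not-¬ (N-intro (edge-sym G yz) S-y) Nu-y
      z≢v : z ≢ v
      z≢v refl = not-¬ (N-intro (edge-sym G yz) S-y) Nv-y
      Nupy = p-into-Nu S-y Nv-y y≢u y≢v
      Nvpy = p-into-Nv S-y Nu-y y≢u y≢v
      through-y : ∀ {a b} → ¬ ExposedNeighbour p a → ¬ Path₅ p a b →
                  N a (p y) ≡ true → N a z ≡ false → p z ≢ z → Edge G (p z) b → ⊥
      through-y {a} stuck no-path Napy Naz matched-z pzb = no-path
        (p y , z , N-edge Napy , N-matched matching stuck Napy , subst (λ x → Edge G x z) (sym (involutive y)) yz ,
         matched-z , pzb , λ z≡py → not-¬ (subst (λ x → N a x ≡ true) (sym z≡py) Napy) Naz)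
      cases : ∀ x y → N u z ≡ x → N v z ≡ y → N u z ≡ true × N v z ≡ true
      cases true true Nuz Nvz = Nuz , Nvz
      cases true false Nuz Nvz = ⊥-elim (through-y no-neighbour-v no-path₅' Nvpy Nvz
        (N-matched matching no-neighbour-u Nuz) (edge-sym G (N-edge (p-into-Nu Sz Nvz z≢u z≢v))))
      cases false true Nuz Nvz = ⊥-elim (through-y no-neighbour-u no-path₅ Nupy Nuz
        (N-matched matching no-neighbour-v Nvz) (edge-sym G (N-edge (p-into-Nv Sz Nuz z≢u z≢v))))
      cases false false Nuz Nvz = ⊥-elim (through-y no-neighbour-u no-path₅ Nupy Nuz
        (λ pz → not-¬ (subst (λ x → N u x ≡ true) pz (p-into-Nu Sz Nvz z≢u z≢v)) Nuz)
        (edge-sym G (N-edge (p-into-Nv Sz Nuz z≢u z≢v))))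

    far : Fin ν → Bool
    far w = not (S w) ∧ (not (w == u) ∧ (not (w == v) ∧ (not (N u w) ∧ not (N v w))))

    far-sound : ∀ {w} → far w ≡ true → Far w
    far-sound e =
      let S-w , e₁ = ∧-≡-true e
          w≠u , e₂ = ∧-≡-true e₁
          w≠v , e₃ = ∧-≡-true e₂
          Nu-w , Nv-w = ∧-≡-true e₃
      in record { S-y = not-≡-true S-w ; y≢u = =/=⇒≢ w≠u ; y≢v = =/=⇒≢ w≠v ; Nu-y = not-≡-true Nu-w ; Nv-y = not-≡-true Nv-w }

    far-complete : ∀ {w} → Far w → far w ≡ true
    far-complete f =
      ∧-intro (not-intro S-y) (∧-intro (≢⇒=/= y≢u) (∧-intro (≢⇒=/= y≢v) (∧-intro (not-intro Nu-y) (not-intro Nv-y))))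
      where open Far f

    common : Fin ν → Bool
    common w = N u w ∧ N v w

    p-common-far : ∀ {w} → common w ≡ true → Far (p w)
    p-common-far {w} e = record
      { S-y = p-outside-S matching (N-outside-S Nuw)
      ; y≢u = λ pw≡u → Nu-≢u Nuw (p-injective matching (trans pw≡u (sym pu)))
      ; y≢v = λ pw≡v → Nu-≢v Nuw (p-injective matching (trans pw≡v (sym pv)))
      ; Nu-y = ¬-not λ Nupw → U.N-disjoint w Nupw Nvw
      ; Nv-y = ¬-not λ Nvpw → V.N-disjoint w Nvpw Nuw
      }
      where
      Nuw = proj₁ (∧-≡-true {N u w} e)
      Nvw = proj₂ (∧-≡-true {N u w} e)

    J : Fin ν → Bool
    J w = far w ∨ U.ends w

    far#ends : Disjoint far U.ends
    far#ends w f e with ∨-≡-true e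
    ... | inj₁ w=u = Far.y≢u (far-sound f) (==⇒≡ {i = w} w=u)
    ... | inj₂ w=v = Far.y≢v (far-sound f) (==⇒≡ {i = w} w=v)

    J-independent : IndependentSet G J
    J-independent i j Ji Jj = ¬-not (clash (∨-≡-true Ji) (∨-≡-true Jj))
      where
      far-end : ∀ {x y} → Far x → U.ends y ≡ true → ¬ Edge G x y
      far-end {x} {y} f e xy with ∨-≡-true e
      ... | inj₁ y=u = not-¬ (N-intro (subst (λ z → Edge G z x) (==⇒≡ {i = y} y=u) (edge-sym G xy)) (Far.S-y f)) (Far.Nu-y f)
      ... | inj₂ y=v = not-¬ (N-intro (subst (λ z → Edge G z x) (==⇒≡ {i = y} y=v) (edge-sym G xy)) (Far.S-y f)) (Far.Nv-y f)
      end-end : ∀ {x y} → x ≡ u ⊎ x ≡ v → y ≡ u ⊎ y ≡ v → ¬ Edge G x y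
      end-end (inj₁ refl) (inj₁ refl) xy = edge-irrefl G xy refl
      end-end (inj₁ refl) (inj₂ refl) xy = no-neighbour-u (v , exposed-v , xy)
      end-end (inj₂ refl) (inj₁ refl) xy = no-neighbour-v (u , exposed-u , xy)
      end-end (inj₂ refl) (inj₂ refl) xy = edge-irrefl G xy refl
      end : ∀ {x} → U.ends x ≡ true → x ≡ u ⊎ x ≡ v
      end {x} e = [ inj₁ ∘ ==⇒≡ {i = x} , inj₂ ∘ ==⇒≡ {i = x} ] (∨-≡-true e)
      clash : far i ≡ true ⊎ U.ends i ≡ true → far j ≡ true ⊎ U.ends j ≡ true → ¬ Edge G i j
      clash (inj₁ fi) (inj₁ fj) ij = not-¬ (proj₁ (far-neighbours (far-sound fi) (Far.S-y (far-sound fj)) ij)) (Far.Nu-y (far-sound fj))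
      clash (inj₁ fi) (inj₂ ej) ij = far-end (far-sound fi) ej ij
      clash (inj₂ ei) (inj₁ fj) ij = far-end (far-sound fj) ei (edge-sym G ij)
      clash (inj₂ ei) (inj₂ ej) ij = end-end (end ei) (end ej) ij

    -- The far vertices, together with u and v, would form an independent set of size > m' + 1.
    no-far-vertex : ∀ {y} → ¬ Far y
    no-far-vertex {y} far-y = <⇒≱ m'+1<|J| (independence J J-independent)
      where
      open ≤-Reasoning
      |N|≤|common| : count (N y) ≤ count common
      |N|≤|common| = count-mono {P = N y} {Q = common} λ z Nyz → uncurry ∧-intro (far-neighbours far-y (N-outside-S Nyz) (N-edge Nyz))
      |common|≤|far| : count common ≤ count far
      |common|≤|far| = count-injective {P = common} {Q = far} p (λ _ → far-complete ∘ p-common-far) (λ _ _ _ _ → p-injective matching)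
      m'+1<|J| : suc m' < count J
      m'+1<|J| = begin-strict
        suc m'                  <⟨ ≤-refl ⟩
        suc (suc m')            ≡⟨ +-comm (1 + 1) m' ⟩
        m' + (1 + 1)            ≤⟨ +-monoˡ-≤ 2 (≤-trans (m'≤|N| y) (≤-trans |N|≤|common| |common|≤|far|)) ⟩
        count far + (1 + 1)     ≡⟨ sym (trans (count-∨ far#ends) (cong (count far +_)
                                      (trans (count-∨ U.a#b) (cong₂ _+_ (count-singleton u) (count-singleton v))))) ⟩
        count J                 ∎

    no-common-neighbour : ∀ {w} → N u w ≡ true → N v w ≡ true → ⊥
    no-common-neighbour Nuw Nvw = no-far-vertex (p-common-far (∧-intro Nuw Nvw))

    near : ∀ {w} → S w ≡ false → w ≢ u → w ≢ v → N u w ≡ true ⊎ N v w ≡ true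
    near {w} Sw w≢u w≢v with N u w in Nuw | N v w in Nvw
    ... | true | _ = inj₁ refl
    ... | false | true = inj₂ refl
    ... | false | false = ⊥-elim (no-far-vertex (record { S-y = Sw ; y≢u = w≢u ; y≢v = w≢v ; Nu-y = Nuw ; Nv-y = Nvw }))

    A B : Fin ν → Bool
    A w = (w == u) ∨ N u w
    B w = (w == v) ∨ N v w

    A-cases : ∀ {w} → A w ≡ true → w ≡ u ⊎ N u w ≡ true
    A-cases {w} e = [ inj₁ ∘ ==⇒≡ {i = w} , inj₂ ] (∨-≡-true e)

    B-cases : ∀ {w} → B w ≡ true → w ≡ v ⊎ N v w ≡ true
    B-cases {w} e = [ inj₁ ∘ ==⇒≡ {i = w} , inj₂ ] (∨-≡-true e)

    A#B : Disjoint A B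
    A#B w Aw Bw with A-cases Aw | B-cases Bw
    ... | inj₁ w≡u | inj₁ w≡v = u≢v (trans (sym w≡u) w≡v)
    ... | inj₁ w≡u | inj₂ Nvw = Nv-≢u Nvw w≡u
    ... | inj₂ Nuw | inj₁ w≡v = Nu-≢v Nuw w≡v
    ... | inj₂ Nuw | inj₂ Nvw = no-common-neighbour Nuw Nvw

    A-outside-S : ∀ w → A w ≡ true → S w ≡ false
    A-outside-S w Aw = [ (λ { refl → Su }) , N-outside-S ] (A-cases Aw)

    B-outside-S : ∀ w → B w ≡ true → S w ≡ false
    B-outside-S w Bw = [ (λ { refl → Sv }) , N-outside-S ] (B-cases Bw)

    A∪B : ∀ w → S w ≡ false → A w ≡ true ⊎ B w ≡ true
    A∪B w Sw with w ≟ u | w ≟ v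
    ... | yes refl | _ = inj₁ refl
    ... | no _ | yes refl = inj₂ refl
    ... | no w≢u | no w≢v = [ inj₁ ∘ ∨-introʳ , inj₂ ∘ ∨-introʳ ] (near Sw w≢u w≢v)

    |A| : count A ≡ suc (count (N u))
    |A| = trans (count-∨ (λ w w=u Nuw → Nu-≢u Nuw (==⇒≡ {i = w} w=u))) (cong (_+ count (N u)) (count-singleton u))

    |B| : count B ≡ suc (count (N v))
    |B| = trans (count-∨ (λ w w=v Nvw → Nv-≢v Nvw (==⇒≡ {i = w} w=v))) (cong (_+ count (N v)) (count-singleton v))

    |A|+|B| : suc (count (N u)) + suc (count (N v)) ≡ suc m' + suc m'
    |A|+|B| = begin
      suc (count (N u)) + suc (count (N v))  ≡⟨ sym (cong₂ _+_ |A| |B|) ⟩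
      count A + count B                      ≡⟨ sym (count-∨ A#B) ⟩
      count (λ w → A w ∨ B w)                ≡⟨ count-cong (λ w → bool-ext (A∨B⇒H w) (H⇒A∨B w)) ⟩
      count (not ∘ S)                        ≡⟨ |H|≡2m ⟩
      suc m' + suc m'                        ∎
      where
      open ≡-Reasoning
      A∨B⇒H : ∀ w → (A w ∨ B w) ≡ true → not (S w) ≡ true
      A∨B⇒H w e = not-intro ([ A-outside-S w , B-outside-S w ] (∨-≡-true e))
      H⇒A∨B : ∀ w → not (S w) ≡ true → (A w ∨ B w) ≡ true
      H⇒A∨B w e = [ ∨-introˡ , ∨-introʳ {A w} ] (A∪B w (not-≡-true e))

    |Nu|≡m' : count (N u) ≡ m'
    |Nu|≡m' = balanced (m'≤|N| u) (m'≤|N| v) |A|+|B|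

    |Nv|≡m' : count (N v) ≡ m'
    |Nv|≡m' = balanced (m'≤|N| v) (m'≤|N| u) (trans (+-comm (suc (count (N v))) _) |A|+|B|)

    -- An edge from N u to N v would close the 5-path u – p i = i – j = p j – v.
    no-A-B-edge : ∀ i j → A i ≡ true → B j ≡ true → ¬ Edge G i j
    no-A-B-edge i j Ai Bj ij with A-cases Ai | B-cases Bj
    ... | inj₁ refl | inj₁ refl = no-neighbour-u (v , exposed-v , ij)
    ... | inj₁ refl | inj₂ Nvj = no-common-neighbour (N-intro ij (N-outside-S Nvj)) Nvj
    ... | inj₂ Nui | inj₁ refl = no-common-neighbour Nui (N-intro (edge-sym G ij) (N-outside-S Nui))
    ... | inj₂ Nui | inj₂ Nvj = no-path₅
          (p i , j , N-edge Nupi , N-matched matching no-neighbour-u Nupi ,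
           subst (λ z → Edge G z j) (sym (involutive i)) ij ,
           N-matched matching no-neighbour-v Nvj , edge-sym G (N-edge Nvpj) ,
           λ j≡pi → no-common-neighbour (subst (λ z → N u z ≡ true) (sym j≡pi) Nupi) Nvj)
      where
      Nupi = p-into-Nu (N-outside-S Nui) (¬-not (no-common-neighbour Nui)) (Nu-≢u Nui) (Nu-≢v Nui)
      Nvpj = p-into-Nv (N-outside-S Nvj) (¬-not (λ Nuj → no-common-neighbour Nuj Nvj)) (Nv-≢u Nvj) (Nv-≢v Nvj)

    N⊆A : ∀ {i} → A i ≡ true → N i ⊆ A
    N⊆A {i} Ai z Niz = [ id , (λ Bz → ⊥-elim (no-A-B-edge i z Ai Bz (N-edge Niz))) ] (A∪B z (N-outside-S Niz))

    N⊆B : ∀ {i} → B i ≡ true → N i ⊆ B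
    N⊆B {i} Bi z Niz = [ (λ Az → ⊥-elim (no-A-B-edge z i Az Bi (edge-sym G (N-edge Niz)))) , id ] (A∪B z (N-outside-S Niz))

    |A|≡m : count A ≡ suc m'
    |A|≡m = trans |A| (cong suc |Nu|≡m')

    |B|≡m : count B ≡ suc m'
    |B|≡m = trans |B| (cong suc |Nv|≡m')

    -- p restricts to a fixed-point-free involution of N u, so m' = |N u| is even.
    m-odd : ∃ λ h → suc m' ≡ suc (h + h)
    m-odd = let h , |Nu|≡h+h = count-even p p-closed (λ w _ → involutive w) (λ w → N-matched matching no-neighbour-u)
            in h , cong suc (trans (sym |Nu|≡m') |Nu|≡h+h)
      where
      p-closed : ∀ w → N u w ≡ true → N u (p w) ≡ true
      p-closed w Nuw = p-into-Nu (N-outside-S Nuw) (¬-not (no-common-neighbour Nuw)) (Nu-≢u Nuw) (Nu-≢v Nuw)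

    stuck⇒split : TwoCliqueSplit G S (suc m')
    stuck⇒split = record
      { A = A ; B = B ; m-odd = m-odd ; count-A = |A|≡m ; count-B = |B|≡m
      ; A-outside-S = A-outside-S ; B-outside-S = B-outside-S ; A#B = A#B ; A∪B = A∪B
      ; A-clique = λ i j Ai Aj → Saturated.adjacent-in-X |A|≡m Ai (N⊆A Ai) j Aj
      ; B-clique = λ i j Bi Bj → Saturated.adjacent-in-X |B|≡m Bi (N⊆B Bi) j Bj
      ; no-A-B-edge = λ i j Ai Bj → ¬-not (no-A-B-edge i j Ai Bj)
      ; S-H-edge = λ i j Si Sj → edge-sym G ([ (λ Aj → Saturated.adjacent-to-S |A|≡m Aj (N⊆A Aj) i Si)
                                               , (λ Bj → Saturated.adjacent-to-S |B|≡m Bj (N⊆B Bj) i Si) ] (A∪B j Sj))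
      }

  -- G − S has an even number 2m' + 2 of vertices while matched vertices come in pairs.
  another-exposed : ∀ {p u} → IsMatching G S p → Exposed p u → ∃ λ v → Exposed p v × v ≢ u
  another-exposed {p} {u} M (Su , pu) with any? (λ w → exposed? M w ×-dec ¬? (w ≟ u))
  ... | yes (v , ev , v≢u) = v , ev , v≢u
  ... | no none = let h , |P|≡h+h = |P|-even in
    ⊥-elim (Odd⇒≢even h (odd-%2 m')
      (trans (sym (+-suc m' m')) (cong pred (trans (sym |H|≡2m) (trans |H|≡1+|P| (cong suc |P|≡h+h))))))
    where
    open IsMatching M
    P : Fin ν → Bool
    P w = not (S w) ∧ not (w == u)
    |H|≡1+|P| : count (not ∘ S) ≡ suc (count P)
    |H|≡1+|P| = count-remove (not ∘ S) (not-intro Su)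
    P-cases : ∀ {w} → P w ≡ true → S w ≡ false × w ≢ u
    P-cases e = let Sw , w≠u = ∧-≡-true e in not-≡-true Sw , =/=⇒≢ w≠u
    closed : ∀ w → P w ≡ true → P (p w) ≡ true
    closed w Pw = let Sw , w≢u = P-cases Pw in
      ∧-intro (not-intro (p-outside-S M Sw)) (≢⇒=/= (λ pw≡u → w≢u (p-injective M (trans pw≡u (sym pu)))))
    |P|-even : ∃ λ h → count P ≡ h + h
    |P|-even = count-even p closed (λ w _ → involutive w) (λ w Pw pw → let Sw , w≢u = P-cases Pw in none (w , (Sw , pw) , w≢u))

  augment-until-stuck : ∀ {p} → IsMatching G S p → Acc _<_ (count (exposed p)) →
           (∃ λ q → IsMatching G S q × Perfect q) ⊎ TwoCliqueSplit G S (suc m')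
  augment-until-stuck {p} M (acc smaller) with any? (exposed? M)
  ... | no none = inj₁ (p , M , λ w Sw pw → none (w , Sw , pw))
  ... | yes (u , eu) with v , ev , v≢u ← another-exposed M eu with improve-or-stuck M eu ev (v≢u ∘ sym)
  ... | inj₂ stuck = inj₂ (stuck⇒split stuck)
  ... | inj₁ better = augment-until-stuck (Improvement.matching better) (smaller (Improvement.fewer-exposed better))

  perfect-or-split : (∃ λ q → IsMatching G S q × Perfect q) ⊎ TwoCliqueSplit G S (suc m')
  perfect-or-split = augment-until-stuck empty-matching (<-wellFounded _)

-- The join decomposition

complete-adj : ∀ {m} {a b : Fin m} → a ≢ b → adj (complete m) a b ≡ true
complete-adj {a = a} {b} a≢b with a ≟ b
... | yes a≡b = ⊥-elim (a≢b a≡b)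
... | no _ = refl

join-shape-cong : ∀ {ν} {G : Graph ν} {c₀ c₁ c₂ n m} → c₀ ≡ n → c₁ ≡ m → c₂ ≡ m →
                  (Σ (Graph c₀) λ G₀ → Isomorphic G (G₀ ∨ᴳ (complete c₁ ∪ᴳ complete c₂))) → JoinShape n m G
join-shape-cong refl refl refl shape = shape

module SplitIsomorphism {ν m : ℕ} {G : Graph ν} {S : Fin ν → Bool} (sp : TwoCliqueSplit G S m) where
  open TwoCliqueSplit sp

  -- A restricted to the vertices outside S, which unsplit S enumerates as Fin (count (not ∘ S)).
  A' : Fin (count (not ∘ S)) → Bool
  A' = A ∘ unsplit S ∘ inj₂

  c₀ c₁ c₂ : ℕ
  c₀ = count S
  c₁ = count A'
  c₂ = count (not ∘ A')

  Parts : Set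
  Parts = Fin c₀ ⊎ (Fin c₁ ⊎ Fin c₂)

  vertex : Parts → Fin ν
  vertex = unsplit S ∘ map₂ (unsplit A')

  classify : Fin ν → Parts
  classify = map₂ (split A') ∘ split S

  vertex∘classify : ∀ i → vertex (classify i) ≡ i
  vertex∘classify i with split S i | unsplit∘split S i
  ... | inj₁ _ | e = e
  ... | inj₂ x | e rewrite unsplit∘split A' x = e

  classify∘vertex : ∀ y → classify (vertex y) ≡ y
  classify∘vertex (inj₁ a) rewrite split∘unsplit S (inj₁ a) = refl
  classify∘vertex (inj₂ z) rewrite split∘unsplit S (inj₂ (unsplit A' z)) | split∘unsplit A' z = refl

  vertex-injective : ∀ {y y'} → vertex y ≡ vertex y' → y ≡ y'
  vertex-injective {y} {y'} e = trans (sym (classify∘vertex y)) (trans (cong classify e) (classify∘vertex y'))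

  clique-index-injective₁ : ∀ {a b} → vertex (inj₂ (inj₁ a)) ≡ vertex (inj₂ (inj₁ b)) → a ≡ b
  clique-index-injective₁ {a} {b} e with refl ← vertex-injective {inj₂ (inj₁ a)} {inj₂ (inj₁ b)} e = refl

  clique-index-injective₂ : ∀ {a b} → vertex (inj₂ (inj₂ a)) ≡ vertex (inj₂ (inj₂ b)) → a ≡ b
  clique-index-injective₂ {a} {b} e with refl ← vertex-injective {inj₂ (inj₂ a)} {inj₂ (inj₂ b)} e = refl

  S-vertex₀ : ∀ a → S (vertex (inj₁ a)) ≡ true
  S-vertex₀ a = P∘unsplit S (inj₁ a)

  S-vertex₁ : ∀ z → S (vertex (inj₂ z)) ≡ false
  S-vertex₁ z = P∘unsplit S (inj₂ (unsplit A' z))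

  A-vertex : ∀ a → A (vertex (inj₂ (inj₁ a))) ≡ true
  A-vertex a = P∘unsplit A' (inj₁ a)

  B-vertex : ∀ b → B (vertex (inj₂ (inj₂ b))) ≡ true
  B-vertex b = [ (λ Aw → ⊥-elim (not-¬ Aw (P∘unsplit A' (inj₂ b)))) , id ]′ (A∪B _ (S-vertex₁ (inj₂ b)))

  c₁≡m : c₁ ≡ m
  c₁≡m = trans (count-unsplit-inj₂ S A)
    (trans (count-cong λ w → bool-ext (proj₂ ∘ ∧-≡-true) λ Aw → ∧-intro (not-intro (A-outside-S w Aw)) Aw) count-A)

  c₂≡m : c₂ ≡ m
  c₂≡m = trans (count-unsplit-inj₂ S (not ∘ A)) (trans (count-cong λ w → bool-ext (outside-A⇒B w) (B⇒outside-A w)) count-B)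
    where
    outside-A⇒B : ∀ w → (not (S w) ∧ not (A w)) ≡ true → B w ≡ true
    outside-A⇒B w e = let Sw , Aw = ∧-≡-true e in
      [ (λ Aw' → ⊥-elim (not-¬ Aw' (not-≡-true Aw))) , id ] (A∪B w (not-≡-true Sw))
    B⇒outside-A : ∀ w → B w ≡ true → (not (S w) ∧ not (A w)) ≡ true
    B⇒outside-A w Bw = ∧-intro (not-intro (B-outside-S w Bw)) (not-intro (¬-not λ Aw → A#B w Aw Bw))

  G₀ : Graph c₀
  G₀ = record
    { adj = λ a b → adj G (vertex (inj₁ a)) (vertex (inj₁ b))
    ; adj-sym = λ a b → adj-sym G (vertex (inj₁ a)) (vertex (inj₁ b))
    ; adj-irrefl = λ a → adj-irrefl G (vertex (inj₁ a))
    }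

  K₂ : Graph (c₁ + c₂)
  K₂ = complete c₁ ∪ᴳ complete c₂

  glue : Parts → Fin (c₀ + (c₁ + c₂))
  glue = join c₀ (c₁ + c₂) ∘ map₂ (join c₁ c₂)

  unglue : Fin (c₀ + (c₁ + c₂)) → Parts
  unglue = map₂ (splitAt c₁) ∘ splitAt c₀

  unglue∘glue : ∀ y → unglue (glue y) ≡ y
  unglue∘glue y rewrite splitAt-join c₀ (c₁ + c₂) (map₂ (join c₁ c₂) y) with y
  ... | inj₁ _ = refl
  ... | inj₂ z rewrite splitAt-join c₁ c₂ z = refl

  glue∘unglue : ∀ j → glue (unglue j) ≡ j
  glue∘unglue j with splitAt c₀ j in e
  ... | inj₁ _ = trans (cong (join c₀ (c₁ + c₂)) (sym e)) (join-splitAt c₀ (c₁ + c₂) j)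
  ... | inj₂ z rewrite join-splitAt c₁ c₂ z = trans (cong (join c₀ (c₁ + c₂)) (sym e)) (join-splitAt c₀ (c₁ + c₂) j)

  relabel : Fin ν ↔ Fin (c₀ + (c₁ + c₂))
  relabel = mk↔ₛ′ (glue ∘ classify) (vertex ∘ unglue)
    (λ j → trans (cong glue (classify∘vertex (unglue j))) (glue∘unglue j))
    (λ i → trans (cong vertex (unglue∘glue (classify i))) (vertex∘classify i))

  adj-cliques : ∀ z z' → adj G (vertex (inj₂ z)) (vertex (inj₂ z')) ≡ adj K₂ (join c₁ c₂ z) (join c₁ c₂ z')
  adj-cliques z z' rewrite splitAt-join c₁ c₂ z | splitAt-join c₁ c₂ z' = cases z z'
    where
    cases : ∀ z z' → adj G (vertex (inj₂ z)) (vertex (inj₂ z')) ≡ comb (adj (complete c₁)) (adj (complete c₂)) false z z'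
    cases (inj₁ a) (inj₁ b) with toSum (a ≟ b)
    ... | inj₁ refl = trans (adj-irrefl G _) (sym (adj-irrefl (complete c₁) a))
    ... | inj₂ a≢b = trans (A-clique _ _ (A-vertex a) (A-vertex b) (a≢b ∘ clique-index-injective₁)) (sym (complete-adj a≢b))
    cases (inj₂ a) (inj₂ b) with toSum (a ≟ b)
    ... | inj₁ refl = trans (adj-irrefl G _) (sym (adj-irrefl (complete c₂) a))
    ... | inj₂ a≢b = trans (B-clique _ _ (B-vertex a) (B-vertex b) (a≢b ∘ clique-index-injective₂)) (sym (complete-adj a≢b))
    cases (inj₁ a) (inj₂ b) = no-A-B-edge _ _ (A-vertex a) (B-vertex b)
    cases (inj₂ a) (inj₁ b) = trans (adj-sym G _ _) (no-A-B-edge _ _ (A-vertex b) (B-vertex a))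

  adj-parts : ∀ y y' → adj G (vertex y) (vertex y') ≡ adj (G₀ ∨ᴳ K₂) (glue y) (glue y')
  adj-parts y y'
    rewrite splitAt-join c₀ (c₁ + c₂) (map₂ (join c₁ c₂) y) | splitAt-join c₀ (c₁ + c₂) (map₂ (join c₁ c₂) y') = cases y y'
    where
    cases : ∀ y y' → adj G (vertex y) (vertex y') ≡ comb (adj G₀) (adj K₂) true (map₂ (join c₁ c₂) y) (map₂ (join c₁ c₂) y')
    cases (inj₁ a) (inj₁ b) = refl
    cases (inj₁ a) (inj₂ z) = S-H-edge _ _ (S-vertex₀ a) (S-vertex₁ z)
    cases (inj₂ z) (inj₁ b) = trans (adj-sym G _ _) (S-H-edge _ _ (S-vertex₀ b) (S-vertex₁ z))
    cases (inj₂ z) (inj₂ z') = adj-cliques z z'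

  join-shape : ∀ {n} → count S ≡ n → JoinShape n m G
  join-shape |S|≡n = join-shape-cong {G = G} |S|≡n c₁≡m c₂≡m (G₀ , relabel , λ i j →
    trans (cong₂ (adj G) (sym (vertex∘classify i)) (sym (vertex∘classify j))) (adj-parts (classify i) (classify j)))

-- In G₀ ∨ (K_m ∪ K_m), deleting the n vertices of G₀ leaves the first K_m as a union of
-- components of odd order m, which therefore cannot be perfectly matched.
join-not-factor-critical : ∀ {n m ν} {G : Graph ν} → Odd m → (G₀ : Graph n) →
                           Isomorphic G (G₀ ∨ᴳ (complete m ∪ᴳ complete m)) → ¬ FactorCritical n G
join-not-factor-critical {n} {m} {ν} {G} m-odd G₀ (σ , σ-adj) fc =
  Odd⇒≢even h m-odd (trans (sym |A|≡m) |A|≡h+h)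
  where
  open Inverse σ using (to)
  inG₀ inA : Fin n ⊎ Fin (m + m) → Bool
  inG₀ = is-inj₁
  inA = [ (λ _ → false) , is-inj₁ ∘ splitAt m ]′
  S : Subset ν
  S = tabulate (inG₀ ∘ splitAt n ∘ to)
  A : Fin ν → Bool
  A = inA ∘ splitAt n ∘ to
  |S|≡n : ∣ S ∣ ≡ n
  |S|≡n = begin
    ∣ S ∣                                             ≡⟨ ∣tabulate∣ (inG₀ ∘ splitAt n ∘ to) ⟩
    count (inG₀ ∘ splitAt n ∘ to)                     ≡⟨ count-↔ σ (inG₀ ∘ splitAt n) ⟩
    count (inG₀ ∘ splitAt n)                          ≡⟨ count-splitAt n inG₀ ⟩
    count {n} (λ _ → true) + count {m + m} (λ _ → false)
      ≡⟨ cong₂ _+_ (count-all {n} (λ _ → refl)) (count-none {m + m} (λ _ → refl)) ⟩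
    n + 0                                             ≡⟨ +-identityʳ n ⟩
    n                                                 ∎
    where open ≡-Reasoning
  |A|≡m : count A ≡ m
  |A|≡m = begin
    count A                                           ≡⟨ count-↔ σ (inA ∘ splitAt n) ⟩
    count (inA ∘ splitAt n)                           ≡⟨ count-splitAt n inA ⟩
    count {n} (λ _ → false) + count (is-inj₁ ∘ splitAt m) ≡⟨ cong₂ _+_ (count-none {n} (λ _ → refl)) (count-splitAt m is-inj₁) ⟩
    count {m} (λ _ → true) + count {m} (λ _ → false)  ≡⟨ cong₂ _+_ (count-all {m} (λ _ → refl)) (count-none {m} (λ _ → refl)) ⟩
    m + 0                                             ≡⟨ +-identityʳ m ⟩
    m                                                 ∎
    where open ≡-Reasoning
  open PerfectMatchingWithout (fc S |S|≡n)
  A∉S : ∀ {i} → A i ≡ true → i ∉ S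
  A∉S {i} Ai i∈S with splitAt n (to i) in e
  ... | inj₁ _ = not-¬ Ai refl
  ... | inj₂ _ = not-¬ (∈-tabulate (inG₀ ∘ splitAt n ∘ to) i∈S) (cong inG₀ e)
  first-clique-closed : ∀ s t → inA s ≡ true → inG₀ t ≡ false →
                        comb (adj G₀) (adj (complete m ∪ᴳ complete m)) true s t ≡ true → inA t ≡ true
  first-clique-closed (inj₂ z) (inj₂ z') _ _ with splitAt m z | splitAt m z'
  ... | inj₁ _ | inj₁ _ = λ _ → refl
  ... | inj₁ _ | inj₂ _ = λ ()
  closed : ∀ i → A i ≡ true → A (partner i) ≡ true
  closed i Ai = first-clique-closed (splitAt n (to i)) (splitAt n (to (partner i))) Ai
    (trans (sym (lookup∘tabulate _ (partner i))) (∉⇒false (partner-out i (A∉S Ai))))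
    (trans (sym (σ-adj i (partner i))) (partner-adj i (A∉S Ai)))
  |A|-even : ∃ λ h → count A ≡ h + h
  |A|-even = count-even partner closed (λ i Ai → partner-invol i (A∉S Ai))
    (λ i Ai e → edge-irrefl G (partner-adj i (A∉S Ai)) (sym e))
  h = proj₁ |A|-even
  |A|≡h+h = proj₂ |A|-even

all-subsets-or : ∀ {k} {P : Subset k → Set} {B : Set} → (∀ S → P S ⊎ B) → (∀ S → P S) ⊎ B
all-subsets-or {zero} f with f []
... | inj₁ p = inj₁ λ { [] → p }
... | inj₂ b = inj₂ b
all-subsets-or {suc k} f with all-subsets-or (f ∘ (true ∷_)) | all-subsets-or (f ∘ (false ∷_))
... | inj₂ b | _ = inj₂ b
... | inj₁ _ | inj₂ b = inj₂ b
... | inj₁ in-S | inj₁ out-S = inj₁ λ { (true ∷ S) → in-S S ; (false ∷ S) → out-S S }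

perfect-matching-without : ∀ {ν} {G : Graph ν} {S : Subset ν} {p} →
                           IsMatching G (lookup S) p → Matchings.Perfect G (lookup S) p → PerfectMatchingWithout G S
perfect-matching-without {S = S} {p} M perfect = record
  { partner = p
  ; partner-out = λ v v∉S pv∈S → perfect v (∉⇒false v∉S) (trans (sym (fixes-S (p v) ([]=⇒lookup pv∈S))) (involutive v))
  ; partner-adj = λ v v∉S → along-edges v (perfect v (∉⇒false v∉S))
  ; partner-invol = λ v _ → involutive v
  }
  where open IsMatching M

module _ {n m' : ℕ} (G : Graph (n + 2 * suc m'))
  (min-degree : MinDegreeAtLeast G (n + suc m' ∸ 1)) (α : IndependenceAtMost G (suc m')) where

  matching-or-split : ∀ S → (∣ S ∣ ≡ n → PerfectMatchingWithout G S) ⊎ (Odd (suc m') × JoinShape n (suc m') G)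
  matching-or-split S with ∣ S ∣ ≟ℕ n
  ... | no |S|≢n = inj₁ (⊥-elim ∘ |S|≢n)
  ... | yes |S|≡n with PerfectMatchingOrSplit.perfect-or-split G (lookup S) n m' |S|≡n' |H|≡2m degree≥ independence
    where
    |S|≡n' : count (lookup S) ≡ n
    |S|≡n' = trans (sym ∣ S ∣≡count) |S|≡n
    |H|≡2m : count (not ∘ lookup S) ≡ suc m' + suc m'
    |H|≡2m = trans (+-cancelˡ-≡ n _ _ (trans (cong (_+ count (not ∘ lookup S)) (sym |S|≡n'))
                   (trans (sym (count-split (λ _ → true) (lookup S))) (count-all (λ _ → refl)))))
                   (cong (suc m' +_) (+-identityʳ (suc m')))
    degree≥ : ∀ w → n + m' ≤ count (adj G w)
    degree≥ w = subst₂ _≤_ (cong (_∸ 1) (+-suc n m')) (∣tabulate∣ (adj G w)) (min-degree w)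
    independence : ∀ J → IndependentSet G J → count J ≤ suc m'
    independence J J-indep = subst (_≤ suc m') (∣tabulate∣ J)
      (α (tabulate J) λ i j i∈J j∈J → J-indep i j (∈-tabulate J i∈J) (∈-tabulate J j∈J))
  ... | inj₁ (p , M , perfect) = inj₁ λ _ → perfect-matching-without M perfect
  ... | inj₂ sp = inj₂ (odd , SplitIsomorphism.join-shape sp (trans (sym ∣ S ∣≡count) |S|≡n))
    where
    odd : Odd (suc m')
    odd = let h , e = TwoCliqueSplit.m-odd sp in subst Odd (sym e) (odd-%2 h)

singleton-independent : ∀ {ν} (G : Graph ν) (v : Fin ν) → Independent G ⁅ v ⁆
singleton-independent G v i j i∈ j∈ =
  subst₂ (λ a b → adj G a b ≡ false) (sym (x∈⁅y⁆⇒x≡y v i∈)) (sym (x∈⁅y⁆⇒x≡y v j∈)) (adj-irrefl G v)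

factor-critical-iff : (n m : ℕ) → 0 < n → (G : Graph (n + 2 * m)) → Connected G →
                      MinDegreeAtLeast G (n + m ∸ 1) → IndependenceAtMost G m →
                      (¬ FactorCritical n G) ⇔ (Odd m × JoinShape n m G)
factor-critical-iff (suc n) zero _ G _ _ α
  with () ← subst (_≤ 0) (∣⁅x⁆∣≡1 {suc n + 2 * zero} zero) (α ⁅ zero ⁆ (singleton-independent G zero))
factor-critical-iff n (suc m') _ G _ min-degree α = mk⇔
  (λ ¬fc → [ ⊥-elim ∘ ¬fc , id ]′ (all-subsets-or (matching-or-split G min-degree α)))
  (λ (odd , G₀ , iso) → join-not-factor-critical {m = suc m'} odd G₀ iso)

-- Sharpness

hub-connected : ∀ {k} (G : Graph (suc k)) → (∀ i → Edge G zero (suc i)) → Connected G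
hub-connected G hub u v = to-hub u ++ from-hub v
  where
  _++_ : ∀ {a b c} → Walk G a b → Walk G b c → Walk G a c
  here ++ w = w
  step e w ++ w' = step e (w ++ w')
  from-hub : ∀ v → Walk G zero v
  from-hub zero = here
  from-hub (suc i) = step (hub i) here
  to-hub : ∀ u → Walk G u zero
  to-hub zero = here
  to-hub (suc i) = step (edge-sym G (hub i)) here

independent? : ∀ {ν} (G : Graph ν) S → Dec (Independent G S)
independent? G S = all? λ i → all? λ j → (i ∈? S) →-dec ((j ∈? S) →-dec (adj G i j ≟ᵇ false))

large-independent-set? : ∀ {ν} (G : Graph ν) k → Dec (∃ λ S → Independent G S × k < ∣ S ∣)
large-independent-set? G k = anySubset? λ S → independent? G S ×-dec (k <?ℕ ∣ S ∣)

independence-at-most : ∀ {ν} (G : Graph ν) k → False (large-independent-set? G k) → IndependenceAtMost G k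
independence-at-most G k none S S-indep = ≮⇒≥ λ k<|S| → toWitnessFalse none (S , S-indep , k<|S|)

isolated-unmatchable : ∀ {ν} {G : Graph ν} {S : Subset ν} {v} → v ∉ S →
                       (∀ x → Edge G v x → x ∈ S) → ¬ PerfectMatchingWithout G S
isolated-unmatchable v∉S N⊆S pm = partner-out _ v∉S (N⊆S _ (partner-adj _ v∉S))
  where open PerfectMatchingWithout pm

pendant-pair-unmatchable : ∀ {ν} {G : Graph ν} {S : Subset ν} {v w c} → v ≢ w → v ∉ S → w ∉ S →
                           (∀ x → Edge G v x → x ∉ S → x ≡ c) → (∀ x → Edge G w x → x ∉ S → x ≡ c) →
                           ¬ PerfectMatchingWithout G S
pendant-pair-unmatchable {v = v} {w} v≢w v∉S w∉S v-only-c w-only-c pm =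
  v≢w (trans (sym (partner-invol v v∉S)) (trans (cong partner (trans pv≡c (sym pw≡c))) (partner-invol w w∉S)))
  where
  open PerfectMatchingWithout pm
  pv≡c = v-only-c _ (partner-adj v v∉S) (partner-out v v∉S)
  pw≡c = w-only-c _ (partner-adj w w∉S) (partner-out w w∉S)

suc∉⁅zero⁆ : ∀ {k} {i : Fin k} → suc i ∉ ⁅ zero ⁆
suc∉⁅zero⁆ i∈ with () ← x∈⁅y⁆⇒x≡y zero i∈

FailsConclusion : (n m : ℕ) → Graph (n + 2 * m) → Set
FailsConclusion n m G = ¬ ((¬ FactorCritical n G) ⇔ (Odd m × JoinShape n m G))

¬odd-2 : ¬ Odd 2
¬odd-2 ()

-- K₁ ∨ (K₁ ∪ K₃): δ = 1 = (ν + n)/2 − 2, α = 2, and deleting the hub isolates a vertex.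
degree-sharp : Graph (1 + 2 * 2)
degree-sharp = complete 1 ∨ᴳ (complete 1 ∪ᴳ complete 3)

-- K₂ ∨ 3K₁: δ = 2 = (ν + n)/2 − 1, α = 3, and deleting a hub leaves three leaves on one vertex.
independence-sharp : Graph (1 + 2 * 2)
independence-sharp = complete 2 ∨ᴳ (complete 1 ∪ᴳ (complete 1 ∪ᴳ complete 1))

degree-sharp-fails : FailsConclusion 1 2 degree-sharp
degree-sharp-fails iff = ¬odd-2 (proj₁ (Equivalence.to iff λ fc →
  isolated-unmatchable {v = suc zero} suc∉⁅zero⁆
    (λ x e → lookup⇒[]= x ⁅ zero ⁆ (toWitness {a? = all? λ x → (adj degree-sharp (suc zero) x ≟ᵇ true)
                                                              →-dec (lookup ⁅ zero ⁆ x ≟ᵇ true)} tt x e))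
    (fc ⁅ zero ⁆ refl)))

independence-sharp-fails : FailsConclusion 1 2 independence-sharp
independence-sharp-fails iff = ¬odd-2 (proj₁ (Equivalence.to iff λ fc →
  pendant-pair-unmatchable {S = ⁅ zero ⁆} {v = v₂} {v₃} (λ ()) suc∉⁅zero⁆ suc∉⁅zero⁆
    (only-v₁ v₂ tt) (only-v₁ v₃ tt) (fc ⁅ zero ⁆ refl)))
  where
  v₁ v₂ v₃ : Fin 5
  v₁ = suc zero
  v₂ = suc (suc zero)
  v₃ = suc (suc (suc zero))
  only-v₁ : ∀ v → True (all? λ x → (adj independence-sharp v x ≟ᵇ true) →-dec (¬? (x ∈? ⁅ zero ⁆) →-dec (x ≟ v₁))) →
            ∀ x → Edge independence-sharp v x → x ∉ ⁅ zero ⁆ → x ≡ v₁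
  only-v₁ v t = toWitness t

SharpnessWitness : (ℕ → ℕ → ℕ) → (ℕ → ℕ) → Set
SharpnessWitness δ α = Σ ℕ λ n → Σ ℕ λ m → 0 < n × Σ (Graph (n + 2 * m)) λ G → Connected G ×
  MinDegreeAtLeast G (δ n m) × IndependenceAtMost G (α m) × FailsConclusion n m G

degree-bound-sharp : SharpnessWitness (λ n m → n + m ∸ 2) id
degree-bound-sharp = 1 , 2 , s≤s z≤n , degree-sharp ,
  hub-connected degree-sharp (toWitness {a? = all? λ i → adj degree-sharp zero (suc i) ≟ᵇ true} tt) ,
  toWitness {a? = all? λ v → 1 ≤? degree degree-sharp v} tt ,
  independence-at-most degree-sharp 2 tt ,
  degree-sharp-fails

independence-bound-sharp : SharpnessWitness (λ n m → n + m ∸ 1) (_+ 1)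
independence-bound-sharp = 1 , 2 , s≤s z≤n , independence-sharp ,
  hub-connected independence-sharp (toWitness {a? = all? λ i → adj independence-sharp zero (suc i) ≟ᵇ true} tt) ,
  toWitness {a? = all? λ v → 2 ≤? degree independence-sharp v} tt ,
  independence-at-most independence-sharp 3 tt ,
  independence-sharp-fails

theorem9 : ((n m : ℕ) → 0 < n → (G : Graph (n + 2 * m)) → Connected G →
    MinDegreeAtLeast G (n + m ∸ 1) → IndependenceAtMost G m →
    ((¬ FactorCritical n G) ⇔ (Odd m × JoinShape n m G)))
    ×
    (Σ ℕ λ n → Σ ℕ λ m → 0 < n × Σ (Graph (n + 2 * m)) λ G → Connected G ×
      MinDegreeAtLeast G (n + m ∸ 2) × IndependenceAtMost G m ×
      ¬ ((¬ FactorCritical n G) ⇔ (Odd m × JoinShape n m G)))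
    ×
    (Σ ℕ λ n → Σ ℕ λ m → 0 < n × Σ (Graph (n + 2 * m)) λ G → Connected G ×
      MinDegreeAtLeast G (n + m ∸ 1) × IndependenceAtMost G (m + 1) ×
      ¬ ((¬ FactorCritical n G) ⇔ (Odd m × JoinShape n m G)))
theorem9 = factor-critical-iff , degree-bound-sharp , independence-bound-sharp
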